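{- Let $p$ be an odd prime and let $G=(V,w)$ be a $p$-periodic weighted graph with quotient graph $\overline G$. Then, reducing coefficients modulo $p$, $$\varphi_G(x)=\varphi_{\overline G}(x^p)\quad\text{in } \mathbb{F}_p[x].$$
   Context: A weighted graph is a pair $G=(V,w)$ where $V=\{v_1,\dots,v_n\}$ is a finite set and $w:V\times V\to \mathbb{Z}_{\ge 0}$ is a symmetric function (equivalently, a finite graph possibly with multiple edges and loops). Its adjacency matrix is the $n\times n$ integer matrix $A(G)=[w(v_i,v_j)]$, and $\varphi_G(x)=\det(xI_n-A(G))\in\mathbb{Z}[x]$ is its characteristic polynomial (independent of the ordering of vertices). An automorphism of $G$ is a permutation $\sigma$ of $V$ with $w(\sigma(u),\sigma(v))=w(u,v)$ for all $u,v$. For an integer $p\ge2$, $G$ is called $p$-periodic if there is an automorphism $h$ with $h^p=\mathrm{Id}$ and $h^i(v)\neq v$ for all $v\in V$ and all $1\le i\le p-1$. The quotient graph $\overline G=(\overline V,\overline w)$ has vertex set $\overline V$ the set of orbits of $V$ under $\langle h\rangle$, and weight $\overline w(\overline u,\overline v)=\sum_{i=0}^{p-1}w(u,h^i(v))$, where $u,v$ are any representatives of the orbits $\overline u,\overline v$. -}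

module Defs where

open import Data.Nat as ℕ using (ℕ; zero; suc)
open import Data.Integer as ℤ using (ℤ; +_)
open import Data.Integer.Divisibility as ℤD using ()
open import Data.Fin using (Fin; zero; suc; punchIn; toℕ)
open import Data.List using (List; []; _∷_; replicate; _++_)
open import Relation.Binary.PropositionalEquality using (_≡_)
open import Data.Product using (Σ; ∃; _×_)

-- Polynomials over ℤ as coefficient lists (lowest degree first).

Poly : Set
Poly = List ℤ

coeff : Poly → ℕ → ℤ
coeff []       _       = + 0
coeff (a ∷ _)  zero    = a
coeff (_ ∷ as) (suc k) = coeff as k

infixl 6 _+P_
_+P_ : Poly → Poly → Poly
[]       +P q        = q
(a ∷ as) +P []       = a ∷ as
(a ∷ as) +P (b ∷ bs) = (a ℤ.+ b) ∷ (as +P bs)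

scaleP : ℤ → Poly → Poly
scaleP c []       = []
scaleP c (a ∷ as) = (c ℤ.* a) ∷ scaleP c as

negP : Poly → Poly
negP = scaleP (ℤ.- (+ 1))

infixl 7 _*P_
_*P_ : Poly → Poly → Poly
[]       *P q = []
(a ∷ as) *P q = scaleP a q +P (+ 0 ∷ (as *P q))

constP : ℤ → Poly
constP c = c ∷ []

X : Poly
X = + 0 ∷ + 1 ∷ []

substXPow : ℕ → Poly → Poly
substXPow p []       = []
substXPow p (a ∷ as) = a ∷ (replicate (p ℕ.∸ 1) (+ 0) ++ substXPow p as)

_≡P_mod_ : Poly → Poly → ℕ → Set
f ≡P g mod p = ∀ k → (+ p) ℤD.∣ (coeff f k ℤ.- coeff g k)

sumFinP : ∀ {n} → (Fin n → Poly) → Poly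
sumFinP {zero}  f = []
sumFinP {suc n} f = f zero +P sumFinP (λ i → f (suc i))

signP : ℕ → Poly → Poly
signP zero          q = q
signP (suc zero)    q = negP q
signP (suc (suc k)) q = signP k q

det : ∀ {n} → (Fin n → Fin n → Poly) → Poly
det {zero}  M = constP (+ 1)
det {suc n} M =
  sumFinP (λ j → signP (toℕ j)
    (M zero j *P det (λ r c → M (suc r) (punchIn j c))))

Weight : ℕ → Set
Weight n = Fin n → Fin n → ℕ

Symmetric : ∀ {n} → Weight n → Set
Symmetric w = ∀ u v → w u v ≡ w v u

δ : ∀ {n} → Fin n → Fin n → Poly
δ zero    zero    = X
δ zero    (suc _) = []
δ (suc _) zero    = []
δ (suc i) (suc j) = δ i j

charPoly : ∀ {n} → Weight n → Poly
charPoly w = det (λ i j → δ i j +P negP (constP (+ (w i j))))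

iter : ∀ {n} → (Fin n → Fin n) → ℕ → Fin n → Fin n
iter h zero    v = v
iter h (suc k) v = h (iter h k v)

-- h is an automorphism of (Fin n, w) with h^p = Id acting freely
-- (h^p = Id forces h to be a permutation).
IsAutomorphism : ∀ {n} → Weight n → (Fin n → Fin n) → Set
IsAutomorphism w h = ∀ u v → w (h u) (h v) ≡ w u v

PeriodicBy : ∀ {n} → ℕ → Weight n → (Fin n → Fin n) → Set
PeriodicBy p w h =
  IsAutomorphism w h
  × (∀ v → iter h p v ≡ v)
  × (∀ v (i : ℕ) → 1 ℕ.≤ i → i ℕ.< p → ¬' (iter h i v ≡ v))
  where
  open import Relation.Nullary using () renaming (¬_ to ¬')

IsOrbitTransversal : ∀ {n m} → ℕ → (Fin n → Fin n) → (Fin m → Fin n) → Set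
IsOrbitTransversal {n} {m} p h s =
  (∀ v → Σ (Fin m) λ a → Σ ℕ λ i → iter h i (s a) ≡ v)
  × (∀ a b (i : ℕ) → iter h i (s a) ≡ s b → a ≡ b)

sumℕ : ℕ → (ℕ → ℕ) → ℕ
sumℕ zero    f = 0
sumℕ (suc k) f = sumℕ k f ℕ.+ f k

quotientWeight : ∀ {n m} → ℕ → Weight n → (Fin n → Fin n) → (Fin m → Fin n) → Weight m
quotientWeight p w h s a b = sumℕ p (λ i → w (s a) (iter h i (s b)))

module Submission where

-- Relabel the vertices as Fin m × ℤ/p through the transversal, so that h becomes the block rotation and
-- xI − A becomes block-circulant. In the Leibniz expansion of its determinant, conjugation by the rotation
-- permutes the terms; orbits of size p contribute p · (…) ≡ 0, so only the rotation-equivariant permutations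
-- survive. Such a permutation is a permutation τ of the orbits together with a shift inside each orbit; it has
-- the sign of τ because p is odd, and summing over the shifts gives ∏ₐ (Σ_c M (a , 0) (τ a , c))^p by the
-- Frobenius endomorphism. Hence φ_G ≡ φ_Ḡ^p, and f^p ≡ f(x^p) in 𝔽ₚ[x].

open import Defs
open import Data.Nat as ℕ using (ℕ; zero; suc; z<s; s<s)
import Data.Nat.Properties as ℕP
open import Data.Nat.Primality using (Prime; prime⇒nonZero; euclidsLemma; ¬prime[1])
open import Data.Nat.Coprimality using (coprime-Bézout; prime⇒coprime)
open import Data.Nat.GCD using (module Bézout)
open import Data.Nat.Divisibility using (_∣_; divides; ∣⇒≤; ∣1⇒≡1; m∣m*n)
open import Data.Nat.DivMod
  using (_%_; _/_; m/n*n≡m; m%n<n; m<n⇒m%n≡m; %-distribˡ-+; m%n%n≡m%n; [m+n]%n≡m%n; n%n≡0; m≡m%n+[m/n]*n)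
open import Data.Nat.Combinatorics using (nCk≡n!/k![n-k]!; k![n∸k]!∣n!; nCn≡1) renaming (_C_ to _choose_)
open import Function using (_∘_)
open import Data.Fin as F using (Fin; zero; suc; toℕ; fromℕ<; punchIn; combine; remQuot; _<_; _↑ˡ_; _↑ʳ_)
import Data.Fin.Properties as FP
open import Data.Fin.Permutation as Perm using (Permutation; _⟨$⟩ʳ_; _⟨$⟩ˡ_)
open import Data.Vec as V using (Vec; []; _∷_; lookup; tabulate)
import Data.Vec.Properties as VP
open import Data.Integer as ℤ using (ℤ; +_; -[1+_]; _-_)
import Data.Integer.Properties as ℤP
import Data.Integer.Divisibility.Signed as ℤS
open import Data.Integer.Tactic.RingSolver using (solve-∀)
open import Data.List using ([]; _∷_; replicate; _++_)
open import Data.Product using (Σ-syntax; ∃; _×_; _,_; proj₁; proj₂)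
open import Relation.Binary.PropositionalEquality as Eq using (_≡_; _≢_; refl; cong; cong₂)
open import Relation.Nullary using (¬_; Dec; yes; no)
open import Relation.Nullary.Decidable using (_×-dec_)
open import Relation.Binary.Definitions using (Tri; tri<; tri≈; tri>)
open import Data.Sum using (_⊎_; inj₁; inj₂)
open import Data.Empty using (⊥-elim)
open import Function.Definitions using (Injective)
open import Algebra.Bundles using (CommutativeMonoid; CommutativeRing)
open import Algebra.Structures using (IsCommutativeRing)
open import Level using (0ℓ)

module PolynomialsModP (p : ℕ) where

  infix 4 _∼_ _≈_

  record _∼_ (a b : ℤ) : Set where
    constructor mk∼
    field p∣a-b : + p ℤS.∣ (a - b)
  open _∼_ public

  private
    a-c≡[a-b]+[b-c] : ∀ a b c → a - c ≡ (a - b) ℤ.+ (b - c)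
    a-c≡[a-b]+[b-c] = solve-∀
    [a+c]-[b+d]≡[a-b]+[c-d] : ∀ a b c d → (a ℤ.+ c) - (b ℤ.+ d) ≡ (a - b) ℤ.+ (c - d)
    [a+c]-[b+d]≡[a-b]+[c-d] = solve-∀
    ac-bd≡a[c-d]+[a-b]d : ∀ a b c d → a ℤ.* c - b ℤ.* d ≡ a ℤ.* (c - d) ℤ.+ (a - b) ℤ.* d
    ac-bd≡a[c-d]+[a-b]d = solve-∀
    b-a≡-[a-b] : ∀ a b → b - a ≡ ℤ.- (a - b)
    b-a≡-[a-b] = solve-∀

  ∼-reflexive : ∀ {a b} → a ≡ b → a ∼ b
  ∼-reflexive {a} refl = mk∼ (ℤS.divides (+ 0) (Eq.trans (ℤP.+-inverseʳ a) (Eq.sym (ℤP.*-zeroˡ (+ p)))))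

  ∼-refl : ∀ {a} → a ∼ a
  ∼-refl = ∼-reflexive refl

  ∼-sym : ∀ {a b} → a ∼ b → b ∼ a
  ∼-sym {a} {b} (mk∼ d) = mk∼ (Eq.subst (+ p ℤS.∣_) (Eq.sym (b-a≡-[a-b] a b)) (ℤS.∣m⇒∣-m d))

  ∼-trans : ∀ {a b c} → a ∼ b → b ∼ c → a ∼ c
  ∼-trans {a} {b} {c} (mk∼ d) (mk∼ e) =
    mk∼ (Eq.subst (+ p ℤS.∣_) (Eq.sym (a-c≡[a-b]+[b-c] a b c)) (ℤS.∣m∣n⇒∣m+n d e))

  +-cong-∼ : ∀ {a b c d} → a ∼ b → c ∼ d → a ℤ.+ c ∼ b ℤ.+ d
  +-cong-∼ {a} {b} {c} {d} (mk∼ x) (mk∼ y) =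
    mk∼ (Eq.subst (+ p ℤS.∣_) (Eq.sym ([a+c]-[b+d]≡[a-b]+[c-d] a b c d)) (ℤS.∣m∣n⇒∣m+n x y))

  *-cong-∼ : ∀ {a b c d} → a ∼ b → c ∼ d → a ℤ.* c ∼ b ℤ.* d
  *-cong-∼ {a} {b} {c} {d} (mk∼ x) (mk∼ y) =
    mk∼ (Eq.subst (+ p ℤS.∣_) (Eq.sym (ac-bd≡a[c-d]+[a-b]d a b c d))
      (ℤS.∣m∣n⇒∣m+n (ℤS.∣n⇒∣m*n a y) (ℤS.∣m⇒∣m*n d x)))

  coeff-+P : ∀ f g k → coeff (f +P g) k ≡ coeff f k ℤ.+ coeff g k
  coeff-+P []       g        k       = Eq.sym (ℤP.+-identityˡ (coeff g k))
  coeff-+P (a ∷ as) []       k       = Eq.sym (ℤP.+-identityʳ (coeff (a ∷ as) k))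
  coeff-+P (a ∷ as) (b ∷ bs) zero    = refl
  coeff-+P (a ∷ as) (b ∷ bs) (suc k) = coeff-+P as bs k

  coeff-scaleP : ∀ c f k → coeff (scaleP c f) k ≡ c ℤ.* coeff f k
  coeff-scaleP c []       k       = Eq.sym (ℤP.*-zeroʳ c)
  coeff-scaleP c (a ∷ as) zero    = refl
  coeff-scaleP c (a ∷ as) (suc k) = coeff-scaleP c as k

  record _≈_ (f g : Poly) : Set where
    constructor mk≈
    field coeff-∼ : ∀ k → coeff f k ∼ coeff g k
  open _≈_ public

  ≈-refl : ∀ {f} → f ≈ f
  ≈-refl = mk≈ λ k → ∼-refl

  ≈-sym : ∀ {f g} → f ≈ g → g ≈ f
  ≈-sym e = mk≈ λ k → ∼-sym (coeff-∼ e k)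

  ≈-trans : ∀ {f g h} → f ≈ g → g ≈ h → f ≈ h
  ≈-trans e e′ = mk≈ λ k → ∼-trans (coeff-∼ e k) (coeff-∼ e′ k)

  coeffs-≡⇒≈ : ∀ {f g} → (∀ k → coeff f k ≡ coeff g k) → f ≈ g
  coeffs-≡⇒≈ e = mk≈ λ k → ∼-reflexive (e k)

  private
    ∼-by-≡ : ∀ {a a′ b b′} → a ≡ a′ → b ≡ b′ → a′ ∼ b′ → a ∼ b
    ∼-by-≡ refl refl x = x

  shift : Poly → Poly
  shift u = + 0 ∷ u

  +P-cong : ∀ {f f′ g g′} → f ≈ f′ → g ≈ g′ → f +P g ≈ f′ +P g′
  +P-cong {f} {f′} {g} {g′} e e′ =
    mk≈ λ k → ∼-by-≡ (coeff-+P f g k) (coeff-+P f′ g′ k) (+-cong-∼ (coeff-∼ e k) (coeff-∼ e′ k))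

  scaleP-cong : ∀ {c c′ f f′} → c ∼ c′ → f ≈ f′ → scaleP c f ≈ scaleP c′ f′
  scaleP-cong {c} {c′} {f} {f′} x e =
    mk≈ λ k → ∼-by-≡ (coeff-scaleP c f k) (coeff-scaleP c′ f′ k) (*-cong-∼ x (coeff-∼ e k))

  ∷-cong : ∀ {a a′ f f′} → a ∼ a′ → f ≈ f′ → a ∷ f ≈ a′ ∷ f′
  ∷-cong x e = mk≈ λ { zero → x ; (suc k) → coeff-∼ e k }

  shift-cong : ∀ {f f′} → f ≈ f′ → shift f ≈ shift f′
  shift-cong = ∷-cong ∼-refl

  +P-assoc : ∀ f g h → (f +P g) +P h ≈ f +P (g +P h)
  +P-assoc f g h = coeffs-≡⇒≈ λ k → begin
      coeff ((f +P g) +P h) k              ≡⟨ coeff-+P (f +P g) h k ⟩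
      coeff (f +P g) k ℤ.+ coeff h k       ≡⟨ cong (ℤ._+ coeff h k) (coeff-+P f g k) ⟩
      (coeff f k ℤ.+ coeff g k) ℤ.+ coeff h k ≡⟨ ℤP.+-assoc (coeff f k) (coeff g k) (coeff h k) ⟩
      coeff f k ℤ.+ (coeff g k ℤ.+ coeff h k) ≡⟨ cong (λ z → coeff f k ℤ.+ z) (coeff-+P g h k) ⟨
      coeff f k ℤ.+ coeff (g +P h) k       ≡⟨ coeff-+P f (g +P h) k ⟨
      coeff (f +P (g +P h)) k              ∎
    where open Eq.≡-Reasoning

  +P-comm : ∀ f g → f +P g ≈ g +P f
  +P-comm f g = coeffs-≡⇒≈ λ k → begin
      coeff (f +P g) k          ≡⟨ coeff-+P f g k ⟩
      coeff f k ℤ.+ coeff g k   ≡⟨ ℤP.+-comm (coeff f k) (coeff g k) ⟩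
      coeff g k ℤ.+ coeff f k   ≡⟨ coeff-+P g f k ⟨
      coeff (g +P f) k          ∎
    where open Eq.≡-Reasoning

  +P-identityʳ : ∀ f → f +P [] ≈ f
  +P-identityʳ []      = ≈-refl
  +P-identityʳ (a ∷ f) = ≈-refl

  [0]≈[] : + 0 ∷ [] ≈ []
  [0]≈[] = mk≈ λ { zero → ∼-refl ; (suc k) → ∼-refl }

  negP-inverseˡ : ∀ f → negP f +P f ≈ []
  negP-inverseˡ f = coeffs-≡⇒≈ λ k → begin
      coeff (negP f +P f) k                     ≡⟨ coeff-+P (negP f) f k ⟩
      coeff (negP f) k ℤ.+ coeff f k            ≡⟨ cong (ℤ._+ coeff f k) (coeff-scaleP _ f k) ⟩
      ℤ.- + 1 ℤ.* coeff f k ℤ.+ coeff f k       ≡⟨ -a+a≡0 (coeff f k) ⟩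
      + 0                                       ∎
    where
    open Eq.≡-Reasoning
    -a+a≡0 : ∀ a → ℤ.- + 1 ℤ.* a ℤ.+ a ≡ + 0
    -a+a≡0 = solve-∀

  scaleP-zero : ∀ {a} g → a ∼ + 0 → scaleP a g ≈ []
  scaleP-zero {a} g x = mk≈ λ k →
    ∼-by-≡ (coeff-scaleP a g k) (Eq.sym (ℤP.*-zeroˡ (coeff g k))) (*-cong-∼ x ∼-refl)

  *P-zeroˡ : ∀ f g → f ≈ [] → f *P g ≈ []
  *P-zeroˡ []       g e = ≈-refl
  *P-zeroˡ (a ∷ as) g e = ≈-trans
    (+P-cong (scaleP-zero g (coeff-∼ e zero)) (shift-cong (*P-zeroˡ as g (mk≈ λ k → coeff-∼ e (suc k)))))
    [0]≈[]

  *P-congˡ : ∀ {f f′} g → f ≈ f′ → f *P g ≈ f′ *P g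
  *P-congˡ {[]}     {f′}       g e = ≈-sym (*P-zeroˡ f′ g (≈-sym e))
  *P-congˡ {a ∷ as} {[]}       g e = *P-zeroˡ (a ∷ as) g e
  *P-congˡ {a ∷ as} {a′ ∷ as′} g e =
    +P-cong (scaleP-cong (coeff-∼ e zero) ≈-refl) (shift-cong (*P-congˡ {as} {as′} g (mk≈ λ k → coeff-∼ e (suc k))))

  +P-interchange : ∀ a b c d → (a +P b) +P (c +P d) ≈ (a +P c) +P (b +P d)
  +P-interchange a b c d = coeffs-≡⇒≈ λ k → begin
      coeff ((a +P b) +P (c +P d)) k
        ≡⟨ Eq.trans (coeff-+P (a +P b) (c +P d) k) (cong₂ ℤ._+_ (coeff-+P a b k) (coeff-+P c d k)) ⟩
      (coeff a k ℤ.+ coeff b k) ℤ.+ (coeff c k ℤ.+ coeff d k)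
        ≡⟨ interchange (coeff a k) (coeff b k) (coeff c k) (coeff d k) ⟩
      (coeff a k ℤ.+ coeff c k) ℤ.+ (coeff b k ℤ.+ coeff d k)
        ≡⟨ Eq.trans (coeff-+P (a +P c) (b +P d) k) (cong₂ ℤ._+_ (coeff-+P a c k) (coeff-+P b d k)) ⟨
      coeff ((a +P c) +P (b +P d)) k ∎
    where
    open Eq.≡-Reasoning
    interchange : ∀ x y z w → (x ℤ.+ y) ℤ.+ (z ℤ.+ w) ≡ (x ℤ.+ z) ℤ.+ (y ℤ.+ w)
    interchange = solve-∀

  scaleP-distribʳ : ∀ a b g → scaleP (a ℤ.+ b) g ≈ scaleP a g +P scaleP b g
  scaleP-distribʳ a b g = coeffs-≡⇒≈ λ k → begin
      coeff (scaleP (a ℤ.+ b) g) k              ≡⟨ coeff-scaleP (a ℤ.+ b) g k ⟩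
      (a ℤ.+ b) ℤ.* coeff g k                   ≡⟨ ℤP.*-distribʳ-+ (coeff g k) a b ⟩
      a ℤ.* coeff g k ℤ.+ b ℤ.* coeff g k        ≡⟨ cong₂ ℤ._+_ (coeff-scaleP a g k) (coeff-scaleP b g k) ⟨
      coeff (scaleP a g) k ℤ.+ coeff (scaleP b g) k ≡⟨ coeff-+P (scaleP a g) (scaleP b g) k ⟨
      coeff (scaleP a g +P scaleP b g) k        ∎
    where open Eq.≡-Reasoning

  scaleP-distribˡ : ∀ a f g → scaleP a (f +P g) ≈ scaleP a f +P scaleP a g
  scaleP-distribˡ a f g = coeffs-≡⇒≈ λ k → begin
      coeff (scaleP a (f +P g)) k                 ≡⟨ coeff-scaleP a (f +P g) k ⟩
      a ℤ.* coeff (f +P g) k                      ≡⟨ cong (a ℤ.*_) (coeff-+P f g k) ⟩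
      a ℤ.* (coeff f k ℤ.+ coeff g k)             ≡⟨ ℤP.*-distribˡ-+ a (coeff f k) (coeff g k) ⟩
      a ℤ.* coeff f k ℤ.+ a ℤ.* coeff g k          ≡⟨ cong₂ ℤ._+_ (coeff-scaleP a f k) (coeff-scaleP a g k) ⟨
      coeff (scaleP a f) k ℤ.+ coeff (scaleP a g) k ≡⟨ coeff-+P (scaleP a f) (scaleP a g) k ⟨
      coeff (scaleP a f +P scaleP a g) k          ∎
    where open Eq.≡-Reasoning

  scaleP-assoc : ∀ a b g → scaleP (a ℤ.* b) g ≈ scaleP a (scaleP b g)
  scaleP-assoc a b g = coeffs-≡⇒≈ λ k → begin
      coeff (scaleP (a ℤ.* b) g) k  ≡⟨ coeff-scaleP (a ℤ.* b) g k ⟩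
      a ℤ.* b ℤ.* coeff g k         ≡⟨ ℤP.*-assoc a b (coeff g k) ⟩
      a ℤ.* (b ℤ.* coeff g k)       ≡⟨ cong (a ℤ.*_) (coeff-scaleP b g k) ⟨
      a ℤ.* coeff (scaleP b g) k    ≡⟨ coeff-scaleP a (scaleP b g) k ⟨
      coeff (scaleP a (scaleP b g)) k ∎
    where open Eq.≡-Reasoning

  shift-+P : ∀ u v → shift (u +P v) ≈ shift u +P shift v
  shift-+P u v = mk≈ λ { zero → ∼-refl ; (suc k) → ∼-refl }

  shift-scaleP : ∀ c u → shift (scaleP c u) ≈ scaleP c (shift u)
  shift-scaleP c u = mk≈ λ { zero → ∼-reflexive (Eq.sym (ℤP.*-zeroʳ c)) ; (suc k) → ∼-refl }

  *P-distribʳ : ∀ f g q → (f +P g) *P q ≈ f *P q +P g *P q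
  *P-distribʳ []       g        q = ≈-refl
  *P-distribʳ (a ∷ as) []       q = ≈-sym (+P-identityʳ _)
  *P-distribʳ (a ∷ as) (b ∷ bs) q = ≈-trans
    (+P-cong (scaleP-distribʳ a b q) (≈-trans (shift-cong (*P-distribʳ as bs q)) (shift-+P (as *P q) (bs *P q))))
    (+P-interchange (scaleP a q) (scaleP b q) (shift (as *P q)) (shift (bs *P q)))

  *P-distribˡ : ∀ q f g → q *P (f +P g) ≈ q *P f +P q *P g
  *P-distribˡ []       f g = ≈-refl
  *P-distribˡ (a ∷ as) f g = ≈-trans
    (+P-cong (scaleP-distribˡ a f g) (≈-trans (shift-cong (*P-distribˡ as f g)) (shift-+P (as *P f) (as *P g))))
    (+P-interchange (scaleP a f) (scaleP a g) (shift (as *P f)) (shift (as *P g)))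

  scaleP-*Pˡ : ∀ c f g → scaleP c f *P g ≈ scaleP c (f *P g)
  scaleP-*Pˡ c []       g = ≈-refl
  scaleP-*Pˡ c (a ∷ as) g = ≈-trans
    (+P-cong (scaleP-assoc c a g) (≈-trans (shift-cong (scaleP-*Pˡ c as g)) (shift-scaleP c (as *P g))))
    (≈-sym (scaleP-distribˡ c (scaleP a g) (shift (as *P g))))

  shift-*Pˡ : ∀ u g → shift u *P g ≈ shift (u *P g)
  shift-*Pˡ u g = +P-cong (scaleP-zero g ∼-refl) ≈-refl

  *P-assoc : ∀ f g h → (f *P g) *P h ≈ f *P (g *P h)
  *P-assoc []       g h = ≈-refl
  *P-assoc (a ∷ as) g h = ≈-trans (*P-distribʳ (scaleP a g) (shift (as *P g)) h)
    (+P-cong (scaleP-*Pˡ a g h) (≈-trans (shift-*Pˡ (as *P g) h) (shift-cong (*P-assoc as g h))))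

  *P-zeroʳ : ∀ g → g *P [] ≈ []
  *P-zeroʳ []       = ≈-refl
  *P-zeroʳ (b ∷ bs) = ≈-trans (shift-cong (*P-zeroʳ bs)) [0]≈[]

  *P-∷ʳ : ∀ g a as → g *P (a ∷ as) ≈ scaleP a g +P shift (g *P as)
  *P-∷ʳ []       a as = ≈-sym [0]≈[]
  *P-∷ʳ (b ∷ bs) a as = ≈-trans (+P-cong (≈-refl {scaleP b (a ∷ as)}) (shift-cong (*P-∷ʳ bs a as))) (mk≈ swap)
    where
    Y = bs *P as
    x+[y+z]≡y+[x+z] : ∀ x y z → x ℤ.+ (y ℤ.+ z) ≡ y ℤ.+ (x ℤ.+ z)
    x+[y+z]≡y+[x+z] = solve-∀
    swap : ∀ k → coeff ((b ℤ.* a ∷ scaleP b as) +P shift (scaleP a bs +P shift Y)) k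
               ∼ coeff ((a ℤ.* b ∷ scaleP a bs) +P shift (scaleP b as +P shift Y)) k
    swap zero    = ∼-reflexive (cong (ℤ._+ + 0) (ℤP.*-comm b a))
    swap (suc k) = ∼-reflexive (begin
        coeff (scaleP b as +P (scaleP a bs +P shift Y)) k
          ≡⟨ Eq.trans (coeff-+P (scaleP b as) _ k)
               (cong (λ z → coeff (scaleP b as) k ℤ.+ z) (coeff-+P (scaleP a bs) (shift Y) k)) ⟩
        coeff (scaleP b as) k ℤ.+ (coeff (scaleP a bs) k ℤ.+ coeff (shift Y) k)
          ≡⟨ x+[y+z]≡y+[x+z] (coeff (scaleP b as) k) (coeff (scaleP a bs) k) (coeff (shift Y) k) ⟩
        coeff (scaleP a bs) k ℤ.+ (coeff (scaleP b as) k ℤ.+ coeff (shift Y) k)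
          ≡⟨ Eq.trans (coeff-+P (scaleP a bs) _ k)
               (cong (λ z → coeff (scaleP a bs) k ℤ.+ z) (coeff-+P (scaleP b as) (shift Y) k)) ⟨
        coeff (scaleP a bs +P (scaleP b as +P shift Y)) k ∎)
      where open Eq.≡-Reasoning

  *P-comm : ∀ f g → f *P g ≈ g *P f
  *P-comm []       g = ≈-sym (*P-zeroʳ g)
  *P-comm (a ∷ as) g = ≈-trans (+P-cong ≈-refl (shift-cong (*P-comm as g))) (≈-sym (*P-∷ʳ g a as))

  *P-congʳ : ∀ f {g g′} → g ≈ g′ → f *P g ≈ f *P g′
  *P-congʳ f {g} {g′} e = ≈-trans (*P-comm f g) (≈-trans (*P-congˡ f e) (*P-comm g′ f))

  *P-identityˡ : ∀ f → constP (+ 1) *P f ≈ f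
  *P-identityˡ f = coeffs-≡⇒≈ λ k → begin
      coeff (scaleP (+ 1) f +P shift []) k         ≡⟨ coeff-+P (scaleP (+ 1) f) (shift []) k ⟩
      coeff (scaleP (+ 1) f) k ℤ.+ coeff (shift []) k ≡⟨ cong₂ ℤ._+_ (coeff-scaleP (+ 1) f k) (coeff-shift[] k) ⟩
      + 1 ℤ.* coeff f k ℤ.+ + 0                     ≡⟨ ℤP.+-identityʳ _ ⟩
      + 1 ℤ.* coeff f k                             ≡⟨ ℤP.*-identityˡ (coeff f k) ⟩
      coeff f k                                     ∎
    where
    open Eq.≡-Reasoning
    coeff-shift[] : ∀ k → coeff (shift []) k ≡ + 0
    coeff-shift[] zero    = refl
    coeff-shift[] (suc k) = refl

  isCommutativeRing : IsCommutativeRing _≈_ _+P_ _*P_ negP [] (constP (+ 1))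
  isCommutativeRing = record
    { isRing = record
      { +-isAbelianGroup = record
        { isGroup = record
          { isMonoid = record
            { isSemigroup = record
              { isMagma = record
                { isEquivalence = record { refl = ≈-refl ; sym = ≈-sym ; trans = ≈-trans }
                ; ∙-cong = +P-cong }
              ; assoc = +P-assoc }
            ; identity = (λ f → ≈-refl) , +P-identityʳ }
          ; inverse = negP-inverseˡ , (λ f → ≈-trans (+P-comm f (negP f)) (negP-inverseˡ f))
          ; ⁻¹-cong = scaleP-cong ∼-refl }
        ; comm = +P-comm }
      ; *-cong = λ {f} {f′} {g} {g′} e e′ → ≈-trans (*P-congˡ g e) (*P-congʳ f′ e′)
      ; *-assoc = *P-assoc
      ; *-identity = *P-identityˡ , (λ f → ≈-trans (*P-comm f _) (*P-identityˡ f))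
      ; distrib = *P-distribˡ , (λ q f g → *P-distribʳ f g q) }
    ; *-comm = *P-comm }

  𝔽ₚ[x] : CommutativeRing 0ℓ 0ℓ
  𝔽ₚ[x] = record { isCommutativeRing = isCommutativeRing }

  ≈⇒≡P-mod : ∀ {f g} → f ≈ g → f ≡P g mod p
  ≈⇒≡P-mod e k = ℤS.∣⇒∣ᵤ (p∣a-b (coeff-∼ e k))

-- Sums over the maps Fin m → Fin n (as vectors) are taken along an explicit enumeration by Fin (n^m).
record Enumeration (A : Set) : Set where
  field
    size          : ℕ
    index         : A → Fin size
    element       : Fin size → A
    element-index : ∀ a → element (index a) ≡ a
    index-element : ∀ i → index (element i) ≡ i
open Enumeration public

finEnumeration : ∀ n → Enumeration (Fin n)
finEnumeration n = record
  { size = n ; index = λ i → i ; element = λ i → i ; element-index = λ _ → refl ; index-element = λ _ → refl }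

module _ {A : Set} (E : Enumeration A) where

  vecSize : ℕ → ℕ
  vecSize zero    = 1
  vecSize (suc n) = size E ℕ.* vecSize n

  vecIndex : ∀ {n} → Vec A n → Fin (vecSize n)
  vecIndex []       = zero
  vecIndex (x ∷ v) = combine (index E x) (vecIndex v)

  vecElement : ∀ n → Fin (vecSize n) → Vec A n
  vecElement zero    i = []
  vecElement (suc n) i =
    element E (proj₁ (remQuot {size E} (vecSize n) i)) ∷ vecElement n (proj₂ (remQuot {size E} (vecSize n) i))

  vecElement-combine : ∀ n a b → vecElement (suc n) (combine a b) ≡ element E a ∷ vecElement n b
  vecElement-combine n a b =
    cong (λ q → element E (proj₁ q) ∷ vecElement n (proj₂ q)) (FP.remQuot-combine {size E} {vecSize n} a b)

  vecElement-index : ∀ {n} (v : Vec A n) → vecElement n (vecIndex v) ≡ v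
  vecElement-index []               = refl
  vecElement-index {suc n} (x ∷ v) =
    Eq.trans (vecElement-combine n (index E x) (vecIndex v)) (cong₂ _∷_ (element-index E x) (vecElement-index v))

  vecIndex-element : ∀ n (i : Fin (vecSize n)) → vecIndex (vecElement n i) ≡ i
  vecIndex-element zero    zero = refl
  vecIndex-element (suc n) i    = Eq.trans
    (cong₂ (combine {size E} {vecSize n}) (index-element E _) (vecIndex-element n _))
    (FP.combine-remQuot {size E} (vecSize n) i)

vecEnumeration : ∀ {A} → Enumeration A → (n : ℕ) → Enumeration (Vec A n)
vecEnumeration E n = record
  { size = vecSize E n ; index = vecIndex E ; element = vecElement E n
  ; element-index = vecElement-index E ; index-element = vecIndex-element E n }

maps : ∀ m n → Enumeration (Vec (Fin n) m)
maps m n = vecEnumeration (finEnumeration n) m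

lookup-extensionality : ∀ {A : Set} {n} {u v : Vec A n} → (∀ i → lookup u i ≡ lookup v i) → u ≡ v
lookup-extensionality {u = u} {v} e =
  Eq.trans (Eq.sym (VP.tabulate∘lookup u)) (Eq.trans (VP.tabulate-cong e) (VP.tabulate∘lookup v))

module CommutativeMonoidSums (M : CommutativeMonoid 0ℓ 0ℓ) where

  open CommutativeMonoid M renaming (Carrier to C; refl to ≈-refl; sym to ≈-sym; trans to ≈-trans)
  open import Algebra.Properties.CommutativeMonoid.Sum M public

  sum-++ : ∀ m n (f : Fin (m ℕ.+ n) → C) → sum f ≈ sum (λ i → f (i ↑ˡ n)) ∙ sum (λ j → f (m ↑ʳ j))
  sum-++ zero    n f = ≈-sym (identityˡ _)
  sum-++ (suc m) n f = ≈-trans (∙-congˡ (sum-++ m n (f ∘ suc))) (≈-sym (assoc _ _ _))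

  sum-combine : ∀ m n (f : Fin (m ℕ.* n) → C) → sum f ≈ sum (λ (i : Fin m) → sum (λ (j : Fin n) → f (combine i j)))
  sum-combine zero    n f = ≈-refl
  sum-combine (suc m) n f = ≈-trans (sum-++ n (m ℕ.* n) f) (∙-congˡ (sum-combine m n (λ x → f (n ↑ʳ x))))

  sum-onlyAt : ∀ {n} (j : Fin n) (f : Fin n → C) → (∀ i → i ≢ j → f i ≈ ε) → sum f ≈ f j
  sum-onlyAt {suc n} j f others = ≈-trans (sum-remove {i = j} f) (≈-trans
    (∙-congˡ (≈-trans (sum-cong-≋ (λ c → others (punchIn j c) (FP.punchInᵢ≢i j c))) (sum-replicate-zero n)))
    (identityʳ _))

module BigOperators (R : CommutativeRing 0ℓ 0ℓ) where

  open CommutativeRing R public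
    renaming (Carrier to C; refl to ≈-refl; sym to ≈-sym; trans to ≈-trans; zero to zeroLaw)
  open import Algebra.Properties.Ring ring public
    using (-‿distribˡ-*; -‿distribʳ-*; -‿involutive; -0#≈0#; -1*x≈-x; -‿+-comm)
  open import Algebra.Properties.Semiring.Sum semiring public using (*-distribˡ-sum; *-distribʳ-sum)
  open import Relation.Binary.Reasoning.Setoid setoid

  module Sum  = CommutativeMonoidSums +-commutativeMonoid
  module Prod = CommutativeMonoidSums *-commutativeMonoid

  Σ : ∀ {n} → (Fin n → C) → C
  Σ = Sum.sum

  Π : ∀ {n} → (Fin n → C) → C
  Π = Prod.sum

  Σ-zero : ∀ {n} (f : Fin n → C) → (∀ i → f i ≈ 0#) → Σ f ≈ 0#
  Σ-zero {n} f z = ≈-trans (Sum.sum-cong-≋ z) (Sum.sum-replicate-zero n)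

  Π-zero : ∀ {n} (f : Fin n → C) (j : Fin n) → f j ≈ 0# → Π f ≈ 0#
  Π-zero {suc n} f j z = ≈-trans (Prod.sum-remove {i = j} f) (≈-trans (*-congʳ z) (zeroˡ _))

  Π-const-even : ∀ t s → s * s ≈ 1# → Π {t ℕ.+ t} (λ _ → s) ≈ 1#
  Π-const-even t s s²≈1 = ≈-trans (Prod.sum-++ t t (λ _ → s))
    (≈-trans (≈-sym (Prod.∑-distrib-+ {t} (λ _ → s) (λ _ → s)))
    (≈-trans (Prod.sum-cong-≋ {t} (λ _ → s²≈1)) (Prod.sum-replicate-zero t)))

  Π-const-odd : ∀ t s → s * s ≈ 1# → Π {suc (t ℕ.+ t)} (λ _ → s) ≈ s
  Π-const-odd t s s²≈1 = ≈-trans (*-congˡ (Π-const-even t s s²≈1)) (*-identityʳ s)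

  -1*-1≈1 : - 1# * - 1# ≈ 1#
  -1*-1≈1 = ≈-trans (-1*x≈-x (- 1#)) (-‿involutive 1#)

  CharacteristicDivides : ℕ → Set
  CharacteristicDivides p = ∀ x → Σ {p} (λ _ → x) ≈ 0#

  𝟙 : ∀ {P : Set} → Dec P → C
  𝟙 (yes _) = 1#
  𝟙 (no _)  = 0#

  ΣE : ∀ {A} → Enumeration A → (A → C) → C
  ΣE E u = Σ (λ i → u (element E i))

  module _ {A : Set} (E : Enumeration A) where

    ΣE-cong : ∀ {u v : A → C} → (∀ a → u a ≈ v a) → ΣE E u ≈ ΣE E v
    ΣE-cong e = Sum.sum-cong-≋ (λ i → e (element E i))

    ΣE-onlyAt : (a₀ : A) (u : A → C) → (∀ a → a ≢ a₀ → u a ≈ 0#) → ΣE E u ≈ u a₀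
    ΣE-onlyAt a₀ u others = ≈-trans
      (Sum.sum-onlyAt (index E a₀) (u ∘ element E)
        (λ i i≢ → others (element E i) (λ e → i≢ (Eq.trans (Eq.sym (index-element E i)) (cong (index E) e)))))
      (reflexive (cong u (element-index E a₀)))

    ΣE-+ : (u v : A → C) → ΣE E (λ a → u a + v a) ≈ ΣE E u + ΣE E v
    ΣE-+ u v = Sum.∑-distrib-+ (u ∘ element E) (v ∘ element E)

    *-distribˡ-ΣE : ∀ c (u : A → C) → c * ΣE E u ≈ ΣE E (λ a → c * u a)
    *-distribˡ-ΣE c u = *-distribˡ-sum c (u ∘ element E)

    *-distribʳ-ΣE : ∀ c (u : A → C) → ΣE E u * c ≈ ΣE E (λ a → u a * c)
    *-distribʳ-ΣE c u = *-distribʳ-sum c (u ∘ element E)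

    ΣE-zero : (u : A → C) → (∀ a → u a ≈ 0#) → ΣE E u ≈ 0#
    ΣE-zero u z = Σ-zero (u ∘ element E) (λ i → z (element E i))

    _≟E_ : (a b : A) → Dec (a ≡ b)
    a ≟E b with index E a F.≟ index E b
    ... | yes e = yes (Eq.trans (Eq.sym (element-index E a)) (Eq.trans (cong (element E) e) (element-index E b)))
    ... | no ne = no (λ e → ne (cong (index E) e))

  ΣE-reindex : ∀ {A B} (EA : Enumeration A) (EB : Enumeration B) (φ : B → A) (ψ : A → B) →
    (∀ a → φ (ψ a) ≡ a) → (∀ b → ψ (φ b) ≡ b) → (u : A → C) → ΣE EA u ≈ ΣE EB (u ∘ φ)
  ΣE-reindex EA EB φ ψ φψ ψφ u = ≈-trans (Sum.sum-permute (u ∘ element EA) π)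
      (Sum.sum-cong-≋ (λ i → reflexive (cong u (element-index EA (φ (element EB i))))))
    where
    π : Permutation (size EB) (size EA)
    π = Perm.permutation (λ i → index EA (φ (element EB i))) (λ j → index EB (ψ (element EA j)))
      (λ j → Eq.trans (cong (λ z → index EA (φ z)) (element-index EB _))
               (Eq.trans (cong (index EA) (φψ _)) (index-element EA j)))
      (λ i → Eq.trans (cong (λ z → index EB (ψ z)) (element-index EA _))
               (Eq.trans (cong (index EB) (ψφ _)) (index-element EB i)))

  ΣE-comm : ∀ {A B} (EA : Enumeration A) (EB : Enumeration B) (u : A → B → C) →
            ΣE EA (λ a → ΣE EB (λ b → u a b)) ≈ ΣE EB (λ b → ΣE EA (λ a → u a b))
  ΣE-comm EA EB u = Sum.∑-comm (λ i j → u (element EA i) (element EB j))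

  ΣE-[] : ∀ {A} (E : Enumeration A) (u : Vec A 0 → C) → ΣE (vecEnumeration E 0) u ≈ u []
  ΣE-[] E u = +-identityʳ (u [])

  ΣE-∷ : ∀ {A} (E : Enumeration A) n (u : Vec A (suc n) → C) →
         ΣE (vecEnumeration E (suc n)) u ≈ ΣE E (λ x → ΣE (vecEnumeration E n) (λ v → u (x ∷ v)))
  ΣE-∷ E n u = ≈-trans (Sum.sum-combine (size E) (vecSize E n) (λ i → u (vecElement E (suc n) i)))
    (Sum.sum-cong-≋ (λ i → Sum.sum-cong-≋ (λ j → reflexive (cong u (vecElement-combine E n i j)))))

  Π-ΣE : ∀ {A} (E : Enumeration A) m (G : Fin m → A → C) →
         Π (λ a → ΣE E (G a)) ≈ ΣE (vecEnumeration E m) (λ v → Π (λ a → G a (lookup v a)))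
  Π-ΣE E zero    G = ≈-sym (ΣE-[] E (λ v → Π (λ a → G a (lookup v a))))
  Π-ΣE E (suc m) G = begin
      ΣE E (G zero) * Π (λ a → ΣE E (G (suc a)))
    ≈⟨ *-congˡ (Π-ΣE E m (G ∘ suc)) ⟩
      ΣE E (G zero) * ΣE Eₘ (λ v → Π (λ a → G (suc a) (lookup v a)))
    ≈⟨ *-distribʳ-ΣE E _ (G zero) ⟩
      ΣE E (λ x → G zero x * ΣE Eₘ (λ v → Π (λ a → G (suc a) (lookup v a))))
    ≈⟨ ΣE-cong E (λ x → *-distribˡ-ΣE Eₘ (G zero x) (λ v → Π (λ a → G (suc a) (lookup v a)))) ⟩
      ΣE E (λ x → ΣE Eₘ (λ v → G zero x * Π (λ a → G (suc a) (lookup v a))))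
    ≈⟨ ΣE-∷ E m (λ v → Π (λ a → G a (lookup v a))) ⟨
      ΣE (vecEnumeration E (suc m)) (λ v → Π (λ a → G a (lookup v a)))
    ∎
    where Eₘ = vecEnumeration E m

  ΣE-maps-combine : ∀ {B Q} r (u : Vec (Fin (B ℕ.* Q)) r → C) →
    ΣE (maps r (B ℕ.* Q)) u ≈ ΣE (maps r B) (λ τ → ΣE (maps r Q) (λ k → u (V.zipWith (combine {B} {Q}) τ k)))
  ΣE-maps-combine {B} {Q} zero u =
    ≈-trans (ΣE-[] (finEnumeration (B ℕ.* Q)) u) (≈-sym (≈-trans
      (ΣE-[] (finEnumeration B) (λ τ → ΣE (maps 0 Q) (λ k → u (pairs τ k))))
      (ΣE-[] (finEnumeration Q) (λ k → u (pairs [] k)))))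
    where
    pairs : Vec (Fin B) 0 → Vec (Fin Q) 0 → Vec (Fin (B ℕ.* Q)) 0
    pairs = V.zipWith combine
  ΣE-maps-combine {B} {Q} (suc r) u = begin
      ΣE (maps (suc r) (B ℕ.* Q)) u
    ≈⟨ ΣE-∷ (finEnumeration (B ℕ.* Q)) r u ⟩
      Σ (λ x → ΣE (maps r (B ℕ.* Q)) (λ v → u (x ∷ v)))
    ≈⟨ Sum.sum-combine B Q (λ x → ΣE (maps r (B ℕ.* Q)) (λ v → u (x ∷ v))) ⟩
      Σ (λ (b : Fin B) → Σ (λ (c : Fin Q) → ΣE (maps r (B ℕ.* Q)) (λ v → u (combine b c ∷ v))))
    ≈⟨ Sum.sum-cong-≋ (λ (b : Fin B) → Sum.sum-cong-≋ (λ (c : Fin Q) →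
         ΣE-maps-combine {B} {Q} r (λ v → u (combine b c ∷ v)))) ⟩
      Σ (λ (b : Fin B) → Σ (λ (c : Fin Q) → ΣE (maps r B) (λ τ → ΣE (maps r Q) (λ k → u (combine b c ∷ pairs τ k)))))
    ≈⟨ Sum.sum-cong-≋ (λ (b : Fin B) →
         ΣE-comm (finEnumeration Q) (maps r B) (λ c τ → ΣE (maps r Q) (λ k → u (combine b c ∷ pairs τ k)))) ⟩
      Σ (λ (b : Fin B) → ΣE (maps r B) (λ τ → Σ (λ (c : Fin Q) → ΣE (maps r Q) (λ k → u (combine b c ∷ pairs τ k)))))
    ≈⟨ Sum.sum-cong-≋ (λ (b : Fin B) →
         ΣE-cong (maps r B) (λ τ → ΣE-∷ (finEnumeration Q) r (λ k → u (pairs (b ∷ τ) k)))) ⟨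
      Σ (λ (b : Fin B) → ΣE (maps r B) (λ τ → ΣE (maps (suc r) Q) (λ k → u (pairs (b ∷ τ) k))))
    ≈⟨ ΣE-∷ (finEnumeration B) r (λ τ → ΣE (maps (suc r) Q) (λ k → u (pairs τ k))) ⟨
      ΣE (maps (suc r) B) (λ τ → ΣE (maps (suc r) Q) (λ k → u (pairs τ k)))
    ∎
    where
    pairs : ∀ {r} → Vec (Fin B) r → Vec (Fin Q) r → Vec (Fin (B ℕ.* Q)) r
    pairs = V.zipWith combine


Collision : ∀ {a b} → (Fin a → Fin b) → Set
Collision {a} f = Σ[ i ∈ Fin a ] Σ[ j ∈ Fin a ] (i < j × f i ≡ f j)

collision⊎injective : ∀ {a b} (f : Fin a → Fin b) → Collision f ⊎ Injective _≡_ _≡_ f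
collision⊎injective f with FP.any? (λ i → FP.any? (λ j → (i FP.<? j) ×-dec (f i F.≟ f j)))
... | yes collision = inj₁ collision
... | no noCollision = inj₂ injective
  where
  injective : Injective _≡_ _≡_ f
  injective {x} {y} e with FP.<-cmp x y
  ... | tri< x<y _ _ = ⊥-elim (noCollision (x , y , x<y , e))
  ... | tri≈ _ x≡y _ = x≡y
  ... | tri> _ _ y<x = ⊥-elim (noCollision (y , x , y<x , Eq.sym e))

injective⇒surjective : ∀ {n} (g : Fin n → Fin n) → Injective _≡_ _≡_ g → ∀ y → ∃ λ x → g x ≡ y
injective⇒surjective {suc n} g inj y with FP.any? (λ x → g x F.≟ y)
... | yes hit = hit
... | no miss = ⊥-elim (ℕP.<-irrefl refl (FP.injective⇒≤ {f = g′} g′-injective))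
  where
  y≢g : ∀ x → y ≢ g x
  y≢g x e = miss (x , Eq.sym e)
  g′ : Fin (suc n) → Fin n
  g′ x = F.punchOut (y≢g x)
  g′-injective : Injective _≡_ _≡_ g′
  g′-injective e = inj (FP.punchOut-injective (y≢g _) (y≢g _) e)

injective⇒permutation : ∀ {n} (g : Fin n → Fin n) → Injective _≡_ _≡_ g → Permutation n n
injective⇒permutation g inj = Perm.permutation g (λ y → proj₁ (injective⇒surjective g inj y))
  (λ y → proj₂ (injective⇒surjective g inj y)) (λ x → inj (proj₂ (injective⇒surjective g inj (g x))))

permutation-injective : ∀ {m n} (π : Permutation m n) → Injective _≡_ _≡_ (π ⟨$⟩ʳ_)
permutation-injective π e = Eq.trans (Eq.sym (Perm.inverseˡ π)) (Eq.trans (cong (π ⟨$⟩ˡ_) e) (Perm.inverseˡ π))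

punchIn-mono-< : ∀ {n} (j : Fin (suc n)) {a b : Fin n} → a < b → punchIn j a < punchIn j b
punchIn-mono-< zero    {a}     {b}     a<b       = s<s a<b
punchIn-mono-< (suc j) {zero}  {suc b} a<b       = z<s
punchIn-mono-< (suc j) {suc a} {suc b} (s<s a<b) = s<s (punchIn-mono-< j a<b)

combine-monoʳ-< : ∀ {m p} (a : Fin m) {i j : Fin p} → i < j → combine a i < combine a j
combine-monoʳ-< {m} {p} a {i} {j} i<j =
  Eq.subst₂ ℕ._<_ (Eq.sym (FP.toℕ-combine a i)) (Eq.sym (FP.toℕ-combine a j)) (ℕP.+-monoʳ-< (p ℕ.* toℕ a) i<j)

combine-cancelʳ-< : ∀ {m p} (a : Fin m) {i j : Fin p} → combine a i < combine a j → i < j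
combine-cancelʳ-< {m} {p} a {i} {j} lt =
  ℕP.+-cancelˡ-< (p ℕ.* toℕ a) (toℕ i) (toℕ j) (Eq.subst₂ ℕ._<_ (FP.toℕ-combine a i) (FP.toℕ-combine a j) lt)


module Sign (R : CommutativeRing 0ℓ 0ℓ) where

  open BigOperators R
  open import Relation.Binary.Reasoning.Setoid setoid

  cmpSign : ∀ {b} → Fin b → Fin b → C
  cmpSign x y with FP.<-cmp x y
  ... | tri< _ _ _ = 1#
  ... | tri≈ _ _ _ = 0#
  ... | tri> _ _ _ = - 1#

  cmpSign-< : ∀ {b} {x y : Fin b} → x < y → cmpSign x y ≈ 1#
  cmpSign-< {x = x} {y} x<y with FP.<-cmp x y
  ... | tri< _ _ _  = ≈-refl
  ... | tri≈ x≮y _ _ = ⊥-elim (x≮y x<y)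
  ... | tri> x≮y _ _ = ⊥-elim (x≮y x<y)

  cmpSign-> : ∀ {b} {x y : Fin b} → y < x → cmpSign x y ≈ - 1#
  cmpSign-> {x = x} {y} y<x with FP.<-cmp x y
  ... | tri< _ _ y≮x = ⊥-elim (y≮x y<x)
  ... | tri≈ _ _ y≮x = ⊥-elim (y≮x y<x)
  ... | tri> _ _ _   = ≈-refl

  cmpSign-≡ : ∀ {b} {x y : Fin b} → x ≡ y → cmpSign x y ≈ 0#
  cmpSign-≡ {x = x} {y} x≡y with FP.<-cmp x y
  ... | tri< _ x≢y _ = ⊥-elim (x≢y x≡y)
  ... | tri≈ _ _ _   = ≈-refl
  ... | tri> _ x≢y _ = ⊥-elim (x≢y x≡y)

  cmpSign-antisym : ∀ {b} (x y : Fin b) → cmpSign y x ≈ - cmpSign x y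
  cmpSign-antisym x y = by-trichotomy (FP.<-cmp x y)
    where
    by-trichotomy : Tri (x < y) (x ≡ y) (y < x) → cmpSign y x ≈ - cmpSign x y
    by-trichotomy (tri< x<y _ _) = ≈-trans (cmpSign-> x<y) (-‿cong (≈-sym (cmpSign-< x<y)))
    by-trichotomy (tri≈ _ x≡y _) =
      ≈-trans (cmpSign-≡ (Eq.sym x≡y)) (≈-trans (≈-sym -0#≈0#) (-‿cong (≈-sym (cmpSign-≡ x≡y))))
    by-trichotomy (tri> _ _ y<x) =
      ≈-trans (cmpSign-< y<x) (≈-trans (≈-sym (-‿involutive 1#)) (-‿cong (≈-sym (cmpSign-> y<x))))

  cmpSign-mono : ∀ {a b} (φ : Fin a → Fin b) → (∀ {x y} → x < y → φ x < φ y) →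
                 ∀ x y → cmpSign (φ x) (φ y) ≈ cmpSign x y
  cmpSign-mono φ φ-mono x y = by-trichotomy (FP.<-cmp x y)
    where
    by-trichotomy : Tri (x < y) (x ≡ y) (y < x) → cmpSign (φ x) (φ y) ≈ cmpSign x y
    by-trichotomy (tri< x<y _ _) = ≈-trans (cmpSign-< (φ-mono x<y)) (≈-sym (cmpSign-< x<y))
    by-trichotomy (tri≈ _ x≡y _) = ≈-trans (cmpSign-≡ (cong φ x≡y)) (≈-sym (cmpSign-≡ x≡y))
    by-trichotomy (tri> _ _ y<x) = ≈-trans (cmpSign-> (φ-mono y<x)) (≈-sym (cmpSign-> y<x))

  cmpSign² : ∀ {b} (x y : Fin b) → x ≢ y → cmpSign x y * cmpSign x y ≈ 1#
  cmpSign² x y x≢y = by-trichotomy (FP.<-cmp x y)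
    where
    by-trichotomy : Tri (x < y) (x ≡ y) (y < x) → cmpSign x y * cmpSign x y ≈ 1#
    by-trichotomy (tri< x<y _ _) = ≈-trans (*-cong (cmpSign-< x<y) (cmpSign-< x<y)) (*-identityˡ 1#)
    by-trichotomy (tri≈ _ x≡y _) = ⊥-elim (x≢y x≡y)
    by-trichotomy (tri> _ _ y<x) = ≈-trans (*-cong (cmpSign-> y<x) (cmpSign-> y<x)) -1*-1≈1

  cmpSign-combine-≢ : ∀ {m p} (u v : Fin m) (i j : Fin p) → u ≢ v →
                      cmpSign (combine u i) (combine v j) ≈ cmpSign u v
  cmpSign-combine-≢ u v i j u≢v = by-trichotomy (FP.<-cmp u v)
    where
    by-trichotomy : Tri (u < v) (u ≡ v) (v < u) → cmpSign (combine u i) (combine v j) ≈ cmpSign u v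
    by-trichotomy (tri< u<v _ _) = ≈-trans (cmpSign-< (FP.combine-monoˡ-< i j u<v)) (≈-sym (cmpSign-< u<v))
    by-trichotomy (tri≈ _ u≡v _) = ⊥-elim (u≢v u≡v)
    by-trichotomy (tri> _ _ v<u) = ≈-trans (cmpSign-> (FP.combine-monoˡ-< j i v<u)) (≈-sym (cmpSign-> v<u))

  cmpSign-combine-≡ : ∀ {m p} (u : Fin m) (i j : Fin p) → cmpSign (combine u i) (combine u j) ≈ cmpSign i j
  cmpSign-combine-≡ u = cmpSign-mono (combine u) (combine-monoʳ-< u)

  when : ∀ {P : Set} → Dec P → C → C
  when (yes _) x = x
  when (no _)  x = 1#

  unless : ∀ {P : Set} → Dec P → C → C
  unless (yes _) x = 1#
  unless (no _)  x = x

  when-yes : ∀ {P : Set} (d : Dec P) → P → ∀ x → when d x ≈ x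
  when-yes (yes _)  _ x = ≈-refl
  when-yes (no ¬p)  p x = ⊥-elim (¬p p)

  when-no : ∀ {P : Set} (d : Dec P) → ¬ P → ∀ x → when d x ≈ 1#
  when-no (yes p) ¬p x = ⊥-elim (¬p p)
  when-no (no _)  _  x = ≈-refl

  when-cong : ∀ {P Q : Set} (d : Dec P) (e : Dec Q) → (P → Q) → (Q → P) → ∀ {x y} → x ≈ y → when d x ≈ when e y
  when-cong (yes p)  (yes q)  P→Q Q→P x≈y = x≈y
  when-cong (yes p)  (no ¬q)  P→Q Q→P x≈y = ⊥-elim (¬q (P→Q p))
  when-cong (no ¬p)  (yes q)  P→Q Q→P x≈y = ⊥-elim (¬p (Q→P q))
  when-cong (no ¬p)  (no ¬q)  P→Q Q→P x≈y = ≈-refl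

  when-* : ∀ {P : Set} (d : Dec P) x y → when d (x * y) ≈ when d x * when d y
  when-* (yes _) x y = ≈-refl
  when-* (no _)  x y = ≈-sym (*-identityˡ 1#)

  Π² : ∀ {a} → (Fin a → Fin a → C) → C
  Π² F = Π (λ i → Π (λ j → F i j))

  Π²-cong : ∀ {a} {F G : Fin a → Fin a → C} → (∀ i j → F i j ≈ G i j) → Π² F ≈ Π² G
  Π²-cong e = Prod.sum-cong-≋ (λ i → Prod.sum-cong-≋ (e i))

  Π²-* : ∀ {a} (F G : Fin a → Fin a → C) → Π² (λ i j → F i j * G i j) ≈ Π² F * Π² G
  Π²-* F G = ≈-trans (Prod.sum-cong-≋ (λ i → Prod.∑-distrib-+ (F i) (G i)))
    (Prod.∑-distrib-+ (λ i → Π (F i)) (λ i → Π (G i)))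

  Π²-one : ∀ {a} (F : Fin a → Fin a → C) → (∀ i j → F i j ≈ 1#) → Π² F ≈ 1#
  Π²-one {a} F F≈1 = ≈-trans (Prod.sum-cong-≋ (λ i → ≈-trans (Prod.sum-cong-≋ (F≈1 i)) (Prod.sum-replicate-zero a)))
    (Prod.sum-replicate-zero a)

  Π²-permute : ∀ {a b} (π : Permutation a b) (F : Fin b → Fin b → C) →
               Π² F ≈ Π² (λ i j → F (π ⟨$⟩ʳ i) (π ⟨$⟩ʳ j))
  Π²-permute π F = ≈-trans (Prod.sum-permute (λ x → Π (F x)) π)
    (Prod.sum-cong-≋ (λ i → Prod.sum-permute (F (π ⟨$⟩ʳ i)) π))

  record Orientation {a} (P : Fin a → Fin a → Set) : Set where
    field
      dec           : ∀ i j → Dec (P i j)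
      irreflexive   : ∀ i → ¬ P i i
      asymmetric    : ∀ i j → P i j → ¬ P j i
      trichotomous  : ∀ i j → i ≢ j → ¬ P i j → P j i

  Π²-reorient : ∀ {a} {P Q : Fin a → Fin a → Set} (OP : Orientation P) (OQ : Orientation Q)
    (E : Fin a → Fin a → C) → (∀ i j → E i j ≈ E j i) →
    Π² (λ i j → when (Orientation.dec OP i j) (E i j)) ≈ Π² (λ i j → when (Orientation.dec OQ i j) (E i j))
  Π²-reorient {a} OP OQ E E-sym = begin
      Π² (λ i j → when (P? i j) (E i j))   ≈⟨ Π²-cong split-P ⟩
      Π² (λ i j → both i j * onlyP i j)   ≈⟨ Π²-* both onlyP ⟩
      Π² both * Π² onlyP                  ≈⟨ *-congˡ (≈-trans (Prod.∑-comm onlyP) (Π²-cong onlyP-transpose)) ⟩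
      Π² both * Π² onlyQ                  ≈⟨ Π²-* both onlyQ ⟨
      Π² (λ i j → both i j * onlyQ i j)   ≈⟨ Π²-cong split-Q ⟨
      Π² (λ i j → when (Q? i j) (E i j))   ∎
    where
    open Orientation
    P? = dec OP
    Q? = dec OQ
    both onlyP onlyQ : Fin a → Fin a → C
    both  i j = when (P? i j) (when (Q? i j) (E i j))
    onlyP i j = when (P? i j) (unless (Q? i j) (E i j))
    onlyQ i j = unless (P? i j) (when (Q? i j) (E i j))
    split-P : ∀ i j → when (P? i j) (E i j) ≈ both i j * onlyP i j
    split-P i j with P? i j | Q? i j
    ... | yes _ | yes _ = ≈-sym (*-identityʳ _)
    ... | yes _ | no _  = ≈-sym (*-identityˡ _)
    ... | no _  | _     = ≈-sym (*-identityˡ 1#)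
    split-Q : ∀ i j → when (Q? i j) (E i j) ≈ both i j * onlyQ i j
    split-Q i j with P? i j | Q? i j
    ... | yes _ | yes _ = ≈-sym (*-identityʳ _)
    ... | yes _ | no _  = ≈-sym (*-identityˡ 1#)
    ... | no _  | yes _ = ≈-sym (*-identityˡ _)
    ... | no _  | no _  = ≈-sym (*-identityˡ 1#)
    onlyP-transpose : ∀ i j → onlyP j i ≈ onlyQ i j
    onlyP-transpose i j with i F.≟ j
    onlyP-transpose i j | yes refl with P? i i | Q? i i
    ... | yes pii | _       = ⊥-elim (irreflexive OP i pii)
    ... | no _    | yes qii = ⊥-elim (irreflexive OQ i qii)
    ... | no _    | no _    = ≈-refl
    onlyP-transpose i j | no i≢j with P? j i | P? i j
    ... | yes pji | yes pij = ⊥-elim (asymmetric OP i j pij pji)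
    ... | no ¬pji | no ¬pij = ⊥-elim (¬pji (trichotomous OP i j i≢j ¬pij))
    ... | no _    | yes _   = ≈-refl
    ... | yes _   | no _ with Q? j i | Q? i j
    ...   | yes qji | yes qij = ⊥-elim (asymmetric OQ i j qij qji)
    ...   | no ¬qji | no ¬qij = ⊥-elim (¬qji (trichotomous OQ i j i≢j ¬qij))
    ...   | yes _   | no _    = ≈-refl
    ...   | no _    | yes _   = E-sym j i

  <-orientation : ∀ {a} → Orientation {a} _<_
  <-orientation = record
    { dec = FP._<?_ ; irreflexive = λ i → FP.<-irrefl refl ; asymmetric = λ i j → FP.<-asym
    ; trichotomous = flip-≮ }
    where
    flip-≮ : ∀ {a} (i j : Fin a) → i ≢ j → ¬ i < j → j < i
    flip-≮ i j i≢j i≮j with FP.<-cmp i j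
    ... | tri< i<j _ _ = ⊥-elim (i≮j i<j)
    ... | tri≈ _ i≡j _ = ⊥-elim (i≢j i≡j)
    ... | tri> _ _ j<i = j<i

  permuted-<-orientation : ∀ {a b} (π : Permutation a b) → Orientation (λ i j → (π ⟨$⟩ʳ i) < (π ⟨$⟩ʳ j))
  permuted-<-orientation π = record
    { dec = λ i j → (π ⟨$⟩ʳ i) FP.<? (π ⟨$⟩ʳ j) ; irreflexive = λ i → FP.<-irrefl refl
    ; asymmetric = λ i j → FP.<-asym
    ; trichotomous = λ i j i≢j → Orientation.trichotomous <-orientation _ _ (λ e → i≢j (permutation-injective π e)) }

  -- Defined on all maps, so that the Leibniz sum can range over all nⁿ maps: non-injective ones get sign 0.
  sgn : ∀ {a b} → (Fin a → Fin b) → C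
  sgn f = Π² (λ i j → when (i FP.<? j) (cmpSign (f i) (f j)))

  sgn-cong : ∀ {a b} {f g : Fin a → Fin b} → (∀ i → f i ≡ g i) → sgn f ≈ sgn g
  sgn-cong e = Π²-cong (λ i j → reflexive (cong₂ (λ x y → when (i FP.<? j) (cmpSign x y)) (e i) (e j)))

  sgn-id : ∀ {a} → sgn {a} (λ i → i) ≈ 1#
  sgn-id {a} = Π²-one {a} (λ i j → when (i FP.<? j) (cmpSign i j)) (λ i j → ordered i j (i FP.<? j))
    where
    ordered : ∀ {a} (i j : Fin a) (d : Dec (i < j)) → when d (cmpSign i j) ≈ 1#
    ordered i j (yes i<j) = cmpSign-< i<j
    ordered i j (no _)    = ≈-refl

  sgn-collision : ∀ {a b} (f : Fin a → Fin b) → Collision f → sgn f ≈ 0#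
  sgn-collision f (i , j , i<j , fi≡fj) = Π-zero _ i (Π-zero _ j (≈-trans (when-yes (i FP.<? j) i<j _) (cmpSign-≡ fi≡fj)))

  sgn-nonInjective : ∀ {a b} (f : Fin a → Fin b) (x y : Fin a) → x ≢ y → f x ≡ f y → sgn f ≈ 0#
  sgn-nonInjective f x y x≢y fx≡fy with FP.<-cmp x y
  ... | tri< x<y _ _ = sgn-collision f (x , y , x<y , fx≡fy)
  ... | tri≈ _ x≡y _ = ⊥-elim (x≢y x≡y)
  ... | tri> _ _ y<x = sgn-collision f (y , x , y<x , Eq.sym fx≡fy)

  private
    -- Each factor (u x, u y) and (x, y) of the products changes sign together when the pair is flipped,
    -- so their product is a symmetric weight and Π²-reorient moves it from the π-order to the standard order.
    sgn≈sgn∘π*sgnπ : ∀ {a b c} (π : Permutation a b) (u : Fin b → Fin c) →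
                     sgn u ≈ sgn (λ i → u (π ⟨$⟩ʳ i)) * sgn (π ⟨$⟩ʳ_)
    sgn≈sgn∘π*sgnπ {a} {b} π u = begin
        sgn u
      ≈⟨ Π²-cong insert-cmpSign ⟩
        Π² (λ x y → when (x FP.<? y) (paired x y))
      ≈⟨ Π²-permute π (λ x y → when (x FP.<? y) (paired x y)) ⟩
        Π² (λ i j → when (v i FP.<? v j) (paired (v i) (v j)))
      ≈⟨ Π²-reorient (permuted-<-orientation π) <-orientation
           (λ i j → paired (v i) (v j)) (λ i j → paired-sym (v i) (v j)) ⟩
        Π² (λ i j → when (i FP.<? j) (paired (v i) (v j)))
      ≈⟨ Π²-cong (λ i j → when-* (i FP.<? j) (cmpSign (u (v i)) (u (v j))) (cmpSign (v i) (v j))) ⟩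
        Π² (λ i j → when (i FP.<? j) (cmpSign (u (v i)) (u (v j))) * when (i FP.<? j) (cmpSign (v i) (v j)))
      ≈⟨ Π²-* (λ i j → when (i FP.<? j) (cmpSign (u (v i)) (u (v j))))
              (λ i j → when (i FP.<? j) (cmpSign (v i) (v j))) ⟩
        sgn (λ i → u (v i)) * sgn v
      ∎
      where
      v = π ⟨$⟩ʳ_
      paired : Fin b → Fin b → C
      paired x y = cmpSign (u x) (u y) * cmpSign x y
      paired-sym : ∀ x y → paired x y ≈ paired y x
      paired-sym x y = ≈-sym (≈-trans (*-cong (cmpSign-antisym (u x) (u y)) (cmpSign-antisym x y))
        (≈-trans (≈-sym (-‿distribˡ-* _ _)) (≈-trans (-‿cong (≈-sym (-‿distribʳ-* _ _))) (-‿involutive _))))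
      insert-cmpSign : ∀ x y → when (x FP.<? y) (cmpSign (u x) (u y)) ≈ when (x FP.<? y) (paired x y)
      insert-cmpSign x y with x FP.<? y
      ... | yes x<y = ≈-sym (≈-trans (*-congˡ (cmpSign-< x<y)) (*-identityʳ _))
      ... | no _    = ≈-refl

  sgn-permutation² : ∀ {a b} (π : Permutation a b) → sgn (π ⟨$⟩ʳ_) * sgn (π ⟨$⟩ʳ_) ≈ 1#
  sgn-permutation² {b = b} π = ≈-sym (≈-trans (≈-sym (sgn-id {b})) (sgn≈sgn∘π*sgnπ π (λ x → x)))

  sgn-∘-permutation : ∀ {a b c} (π : Permutation a b) (u : Fin b → Fin c) →
                      sgn (λ i → u (π ⟨$⟩ʳ i)) ≈ sgn u * sgn (π ⟨$⟩ʳ_)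
  sgn-∘-permutation π u = begin
      sgn (u ∘ π′)                      ≈⟨ *-identityʳ _ ⟨
      sgn (u ∘ π′) * 1#                 ≈⟨ *-congˡ (sgn-permutation² π) ⟨
      sgn (u ∘ π′) * (sgn π′ * sgn π′)  ≈⟨ *-assoc _ _ _ ⟨
      (sgn (u ∘ π′) * sgn π′) * sgn π′  ≈⟨ *-congʳ (sgn≈sgn∘π*sgnπ π u) ⟨
      sgn u * sgn π′                    ∎
    where π′ = π ⟨$⟩ʳ_

  sgn-conjugate : ∀ {n b} (π : Permutation n b) (f : Fin b → Fin b) →
                  sgn (λ x → π ⟨$⟩ˡ (f (π ⟨$⟩ʳ x))) ≈ sgn f
  sgn-conjugate {n} π f with collision⊎injective f
  ... | inj₁ (i , j , i<j , fi≡fj) = ≈-trans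
      (sgn-nonInjective (πˡ ∘ f ∘ πʳ) (πˡ i) (πˡ j) (λ e → FP.<-irrefl (permutation-injective (Perm.flip π) e) i<j)
        (cong πˡ (Eq.trans (cong f (Perm.inverseʳ π)) (Eq.trans fi≡fj (cong f (Eq.sym (Perm.inverseʳ π)))))))
      (≈-sym (sgn-collision f (i , j , i<j , fi≡fj)))
    where
    πˡ = π ⟨$⟩ˡ_
    πʳ = π ⟨$⟩ʳ_
  ... | inj₂ f-injective = begin
      sgn (πˡ ∘ f ∘ πʳ)                 ≈⟨ sgn-∘-permutation π (πˡ ∘ f) ⟩
      sgn (πˡ ∘ (σ ⟨$⟩ʳ_)) * sgn πʳ      ≈⟨ *-congʳ (sgn-∘-permutation σ πˡ) ⟩
      (sgn πˡ * sgn f) * sgn πʳ          ≈⟨ ≈-trans (*-congʳ (*-comm _ _)) (*-assoc _ _ _) ⟩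
      sgn f * (sgn πˡ * sgn πʳ)          ≈⟨ *-congˡ (sgn-∘-permutation π πˡ) ⟨
      sgn f * sgn (πˡ ∘ πʳ)              ≈⟨ *-congˡ (≈-trans (sgn-cong {f = πˡ ∘ πʳ} {g = λ x → x} (λ _ → Perm.inverseˡ π))
                                                            (sgn-id {n})) ⟩
      sgn f * 1#                         ≈⟨ *-identityʳ _ ⟩
      sgn f                              ∎
    where
    πˡ = π ⟨$⟩ˡ_
    πʳ = π ⟨$⟩ʳ_
    σ = injective⇒permutation f f-injective

module Determinant (R : CommutativeRing 0ℓ 0ℓ) where

  open BigOperators R
  open Sign R
  open import Relation.Binary.Reasoning.Setoid setoid

  -1^ : ℕ → C
  -1^ zero    = 1#
  -1^ (suc k) = - -1^ k

  alternate : ℕ → C → C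
  alternate zero          x = x
  alternate (suc zero)    x = - x
  alternate (suc (suc k)) x = alternate k x

  alternate≈-1^* : ∀ k x → alternate k x ≈ -1^ k * x
  alternate≈-1^* zero          x = ≈-sym (*-identityˡ x)
  alternate≈-1^* (suc zero)    x = ≈-sym (-1*x≈-x x)
  alternate≈-1^* (suc (suc k)) x = ≈-trans (alternate≈-1^* k x) (*-congʳ (≈-sym (-‿involutive _)))

  laplace : ∀ {n} → (Fin n → Fin n → C) → C
  laplace {zero}  M = 1#
  laplace {suc n} M = Σ (λ j → alternate (toℕ j) (M zero j * laplace (λ r c → M (suc r) (punchIn j c))))

  leibniz : ∀ {n} → (Fin n → Fin n → C) → C
  leibniz {n} M = ΣE (maps n n) (λ f → sgn (lookup f) * Π (λ i → M i (lookup f i)))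

  leibniz-cong : ∀ {n} {A B : Fin n → Fin n → C} → (∀ i j → A i j ≈ B i j) → leibniz A ≈ leibniz B
  leibniz-cong {n} e = ΣE-cong (maps n n) (λ f → *-congˡ {sgn (lookup f)} (Prod.sum-cong-≋ (λ i → e i (lookup f i))))

  sgn-∷ : ∀ {n b} (f : Fin (suc n) → Fin b) →
          sgn f ≈ Π (λ r → cmpSign (f zero) (f (suc r))) * sgn (λ r → f (suc r))
  sgn-∷ {n} f = *-cong row-zero (Prod.sum-cong-≋ row-suc)
    where
    row-zero : Π (λ (j : Fin (suc n)) → when (zero {n} FP.<? j) (cmpSign (f zero) (f j)))
             ≈ Π (λ r → cmpSign (f zero) (f (suc r)))
    row-zero = ≈-trans
      (*-cong (when-no (zero {n} FP.<? zero {n}) (λ ()) (cmpSign (f zero) (f zero)))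
        (Prod.sum-cong-≋ (λ r → when-yes (zero {n} FP.<? suc r) z<s (cmpSign (f zero) (f (suc r))))))
      (*-identityˡ _)
    row-suc : ∀ i → Π (λ (j : Fin (suc n)) → when (suc i FP.<? j) (cmpSign (f (suc i)) (f j)))
                  ≈ Π (λ r → when (i FP.<? r) (cmpSign (f (suc i)) (f (suc r))))
    row-suc i = ≈-trans
      (*-cong (when-no (suc i FP.<? zero {n}) (λ ()) (cmpSign (f (suc i)) (f zero)))
        (Prod.sum-cong-≋ (λ r →
          when-cong (suc i FP.<? suc r) (i FP.<? r) ℕ.s<s⁻¹ s<s (≈-refl {cmpSign (f (suc i)) (f (suc r))}))))
      (*-identityˡ _)

  sgn-punchIn : ∀ {n} (j : Fin (suc n)) (g : Fin n → Fin n) → sgn (λ r → punchIn j (g r)) ≈ sgn g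
  sgn-punchIn j g = Π²-cong (λ i k →
    when-cong (i FP.<? k) (i FP.<? k) (λ x → x) (λ x → x) (cmpSign-mono (punchIn j) (punchIn-mono-< j) (g i) (g k)))

  Π-cmpSign-punchIn : ∀ {n} (j : Fin (suc n)) → Π (λ c → cmpSign j (punchIn j c)) ≈ -1^ (toℕ j)
  Π-cmpSign-punchIn {n} zero =
    ≈-trans (Prod.sum-cong-≋ {n} {λ c → cmpSign zero (punchIn zero c)} {λ _ → 1#}
               (λ c → cmpSign-< {x = zero} {y = suc c} z<s))
      (Prod.sum-replicate-zero n)
  Π-cmpSign-punchIn {suc n} (suc j) = begin
      cmpSign (suc j) zero * Π (λ c → cmpSign (suc j) (suc (punchIn j c)))
    ≈⟨ *-cong (cmpSign-> {x = suc j} {y = zero} z<s) (Prod.sum-cong-≋ (λ c → cmpSign-mono suc s<s j (punchIn j c))) ⟩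
      - 1# * Π (λ c → cmpSign j (punchIn j c))
    ≈⟨ *-congˡ (Π-cmpSign-punchIn j) ⟩
      - 1# * -1^ (toℕ j)
    ≈⟨ -1*x≈-x _ ⟩
      - -1^ (toℕ j)
    ∎

  sgn-punchIn-∷ : ∀ {n} (j : Fin (suc n)) (g : Vec (Fin n) n) →
                  sgn (lookup (j ∷ V.map (punchIn j) g)) ≈ -1^ (toℕ j) * sgn (lookup g)
  sgn-punchIn-∷ {n} j g = begin
      sgn (lookup (j ∷ V.map (punchIn j) g))
    ≈⟨ sgn-∷ (lookup (j ∷ V.map (punchIn j) g)) ⟩
      Π (λ r → cmpSign j (lookup (V.map (punchIn j) g) r)) * sgn (lookup (V.map (punchIn j) g))
    ≈⟨ *-cong (Prod.sum-cong-≋ (λ r → reflexive (cong (cmpSign j) (VP.lookup-map r (punchIn j) g))))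
              (≈-trans (sgn-cong (λ r → VP.lookup-map r (punchIn j) g)) (sgn-punchIn j (lookup g))) ⟩
      Π (λ r → cmpSign j (punchIn j (lookup g r))) * sgn (lookup g)
    ≈⟨ by-injectivity (collision⊎injective (lookup g)) ⟩
      -1^ (toℕ j) * sgn (lookup g)
    ∎
    where
    by-injectivity : Collision (lookup g) ⊎ Injective _≡_ _≡_ (lookup g) →
      Π (λ r → cmpSign j (punchIn j (lookup g r))) * sgn (lookup g) ≈ -1^ (toℕ j) * sgn (lookup g)
    by-injectivity (inj₁ c) =
      ≈-trans (*-congˡ (sgn-collision _ c))
        (≈-trans (zeroʳ _) (≈-sym (≈-trans (*-congˡ (sgn-collision _ c)) (zeroʳ _))))
    by-injectivity (inj₂ g-injective) = *-congʳ (≈-trans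
      (≈-sym (Prod.sum-permute (λ c → cmpSign j (punchIn j c)) (injective⇒permutation (lookup g) g-injective)))
      (Π-cmpSign-punchIn j))

  ΣE-avoiding : ∀ {k} a (j : Fin (suc k)) (G : Vec (Fin (suc k)) a → C) → (∀ f r → lookup f r ≡ j → G f ≈ 0#) →
                ΣE (maps a (suc k)) G ≈ ΣE (maps a k) (λ g → G (V.map (punchIn j) g))
  ΣE-avoiding {k} zero j G hits-j =
    ≈-trans (ΣE-[] (finEnumeration (suc k)) G) (≈-sym (ΣE-[] (finEnumeration k) (λ g → G (V.map (punchIn j) g))))
  ΣE-avoiding {k} (suc a) j G hits-j = begin
      ΣE (maps (suc a) (suc k)) G
    ≈⟨ ΣE-∷ (finEnumeration (suc k)) a G ⟩
      Σ (λ x → ΣE (maps a (suc k)) (λ f → G (x ∷ f)))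
    ≈⟨ Sum.sum-remove {i = j} (λ x → ΣE (maps a (suc k)) (λ f → G (x ∷ f))) ⟩
      ΣE (maps a (suc k)) (λ f → G (j ∷ f)) + Σ (λ c → ΣE (maps a (suc k)) (λ f → G (punchIn j c ∷ f)))
    ≈⟨ +-cong (ΣE-zero (maps a (suc k)) _ (λ f → hits-j (j ∷ f) zero refl))
              (Sum.sum-cong-≋ (λ c → ΣE-avoiding a j _ (λ f r → hits-j (punchIn j c ∷ f) (suc r)))) ⟩
      0# + Σ (λ c → ΣE (maps a k) (λ g → G (punchIn j c ∷ V.map (punchIn j) g)))
    ≈⟨ +-identityˡ _ ⟩
      Σ (λ c → ΣE (maps a k) (λ g → G (punchIn j c ∷ V.map (punchIn j) g)))
    ≈⟨ ΣE-∷ (finEnumeration k) a (λ g → G (V.map (punchIn j) g)) ⟨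
      ΣE (maps (suc a) k) (λ g → G (V.map (punchIn j) g))
    ∎

  -- Group the Leibniz terms by f 0 = j: maps hitting j again vanish, and the others are
  -- j ∷ punchIn j ∘ g, of sign (-1)^j · sgn g.
  laplace≈leibniz : ∀ {n} (M : Fin n → Fin n → C) → laplace M ≈ leibniz M
  laplace≈leibniz {zero}  M =
    ≈-sym (≈-trans (ΣE-[] (finEnumeration 0) (λ f → sgn (lookup f) * Π (λ i → M i (lookup f i)))) (*-identityˡ 1#))
  laplace≈leibniz {suc n} M = ≈-sym (begin
      leibniz M
    ≈⟨ ΣE-∷ (finEnumeration (suc n)) n term ⟩
      Σ (λ j → ΣE (maps n (suc n)) (λ f → term (j ∷ f)))
    ≈⟨ Sum.sum-cong-≋ (λ j → ΣE-avoiding n j (λ f → term (j ∷ f)) (term-collision j)) ⟩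
      Σ (λ j → ΣE (maps n n) (λ g → term (j ∷ V.map (punchIn j) g)))
    ≈⟨ Sum.sum-cong-≋ (λ j → ΣE-cong (maps n n) (term-punchIn j)) ⟩
      Σ (λ j → ΣE (maps n n) (λ g → -1^ (toℕ j) * (M zero j * minorTerm j g)))
    ≈⟨ Sum.sum-cong-≋ (λ j → ≈-trans (≈-sym (*-distribˡ-ΣE (maps n n) (-1^ (toℕ j)) (λ g → M zero j * minorTerm j g)))
                                     (*-congˡ { -1^ (toℕ j)} (≈-sym (*-distribˡ-ΣE (maps n n) (M zero j) (minorTerm j))))) ⟩
      Σ (λ j → -1^ (toℕ j) * (M zero j * leibniz (minor j)))
    ≈⟨ Sum.sum-cong-≋ (λ j → ≈-trans (*-congˡ { -1^ (toℕ j)} (*-congˡ {M zero j} (≈-sym (laplace≈leibniz (minor j)))))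
                                     (≈-sym (alternate≈-1^* (toℕ j) _))) ⟩
      laplace M
    ∎)
    where
    term : Vec (Fin (suc n)) (suc n) → C
    term f = sgn (lookup f) * Π (λ i → M i (lookup f i))
    minor : Fin (suc n) → Fin n → Fin n → C
    minor j r c = M (suc r) (punchIn j c)
    minorTerm : Fin (suc n) → Vec (Fin n) n → C
    minorTerm j g = sgn (lookup g) * Π (λ r → minor j r (lookup g r))
    term-collision : ∀ j (f : Vec (Fin (suc n)) n) r → lookup f r ≡ j → term (j ∷ f) ≈ 0#
    term-collision j f r e = ≈-trans (*-congʳ (sgn-collision (lookup (j ∷ f)) (zero , suc r , z<s , Eq.sym e))) (zeroˡ _)
    term-punchIn : ∀ j g → term (j ∷ V.map (punchIn j) g) ≈ -1^ (toℕ j) * (M zero j * minorTerm j g)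
    term-punchIn j g = begin
        sgn (lookup (j ∷ V.map (punchIn j) g)) * (M zero j * Π (λ r → M (suc r) (lookup (V.map (punchIn j) g) r)))
      ≈⟨ *-cong (sgn-punchIn-∷ j g)
                (*-congˡ (Prod.sum-cong-≋ (λ r → reflexive (cong (M (suc r)) (VP.lookup-map r (punchIn j) g))))) ⟩
        (-1^ (toℕ j) * sgn (lookup g)) * (M zero j * Π (λ r → minor j r (lookup g r)))
      ≈⟨ [ab][cd]≈a[c[bd]] _ _ _ _ ⟩
        -1^ (toℕ j) * (M zero j * minorTerm j g)
      ∎
      where
      [ab][cd]≈a[c[bd]] : ∀ a b c d → (a * b) * (c * d) ≈ a * (c * (b * d))
      [ab][cd]≈a[c[bd]] a b c d = ≈-trans (*-assoc a b (c * d))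
        (*-congˡ (≈-trans (≈-sym (*-assoc b c d)) (≈-trans (*-congʳ (*-comm b c)) (*-assoc c b d))))

  leibniz-relabel : ∀ {N n} (β : Permutation N n) (A : Fin n → Fin n → C) →
                    leibniz A ≈ leibniz (λ x y → A (β ⟨$⟩ʳ x) (β ⟨$⟩ʳ y))
  leibniz-relabel {N} {n} β A = begin
      leibniz A
    ≈⟨ ΣE-reindex (maps n n) (maps N N) conj conj⁻¹ conj-conj⁻¹ conj⁻¹-conj
         (λ f → sgn (lookup f) * Π (λ i → A i (lookup f i))) ⟩
      ΣE (maps N N) (λ f → sgn (lookup (conj f)) * Π (λ v → A v (lookup (conj f) v)))
    ≈⟨ ΣE-cong (maps N N) (λ f → *-cong (sgn-conj f) (Π-conj f)) ⟩
      leibniz (λ x y → A (βʳ x) (βʳ y))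
    ∎
    where
    βʳ = β ⟨$⟩ʳ_
    βˡ = β ⟨$⟩ˡ_
    conj : Vec (Fin N) N → Vec (Fin n) n
    conj f = tabulate (λ v → βʳ (lookup f (βˡ v)))
    conj⁻¹ : Vec (Fin n) n → Vec (Fin N) N
    conj⁻¹ g = tabulate (λ x → βˡ (lookup g (βʳ x)))
    conj-conj⁻¹ : ∀ g → conj (conj⁻¹ g) ≡ g
    conj-conj⁻¹ g = lookup-extensionality λ v → Eq.trans (VP.lookup∘tabulate _ v)
      (Eq.trans (cong βʳ (VP.lookup∘tabulate _ (βˡ v))) (Eq.trans (Perm.inverseʳ β) (cong (lookup g) (Perm.inverseʳ β))))
    conj⁻¹-conj : ∀ f → conj⁻¹ (conj f) ≡ f
    conj⁻¹-conj f = lookup-extensionality λ x → Eq.trans (VP.lookup∘tabulate _ x)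
      (Eq.trans (cong βˡ (VP.lookup∘tabulate _ (βʳ x))) (Eq.trans (Perm.inverseˡ β) (cong (lookup f) (Perm.inverseˡ β))))
    sgn-conj : ∀ f → sgn (lookup (conj f)) ≈ sgn (lookup f)
    sgn-conj f = ≈-trans (sgn-cong {f = lookup (conj f)} (λ v → VP.lookup∘tabulate _ v))
                         (sgn-conjugate (Perm.flip β) (lookup f))
    Π-conj : ∀ f → Π (λ v → A v (lookup (conj f) v)) ≈ Π (λ x → A (βʳ x) (βʳ (lookup f x)))
    Π-conj f = ≈-trans (Prod.sum-cong-≋ (λ v → reflexive (cong (A v) (VP.lookup∘tabulate _ v))))
      (≈-trans (Prod.sum-permute (λ v → A v (βʳ (lookup f (βˡ v)))) β)
        (Prod.sum-cong-≋ (λ x → reflexive (cong (λ z → A (βʳ x) (βʳ (lookup f z))) (Perm.inverseˡ β)))))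

iterate : ∀ {A : Set} → (A → A) → ℕ → A → A
iterate f zero    a = a
iterate f (suc k) a = f (iterate f k a)

iterate-+ : ∀ {A : Set} (f : A → A) m n a → iterate f (m ℕ.+ n) a ≡ iterate f m (iterate f n a)
iterate-+ f zero    n a = refl
iterate-+ f (suc m) n a = cong f (iterate-+ f m n a)

iterate-fixedPoint : ∀ {A : Set} (f : A → A) {b} → f b ≡ b → ∀ k → iterate f k b ≡ b
iterate-fixedPoint f fb≡b zero    = refl
iterate-fixedPoint f fb≡b (suc k) = Eq.trans (cong f (iterate-fixedPoint f fb≡b k)) fb≡b

iterate-comm : ∀ {A : Set} (f : A → A) k a → iterate f k (f a) ≡ f (iterate f k a)
iterate-comm f zero    a = refl
iterate-comm f (suc k) a = cong f (iterate-comm f k a)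

iterate-inverse : ∀ {A : Set} (f g : A → A) → (∀ a → g (f a) ≡ a) → ∀ k a → iterate g k (iterate f k a) ≡ a
iterate-inverse f g g∘f≡id zero    a = refl
iterate-inverse f g g∘f≡id (suc k) a = Eq.trans (cong (λ z → g (iterate g k z)) (Eq.sym (iterate-comm f k a)))
  (Eq.trans (cong g (iterate-inverse f g g∘f≡id k (f a))) (g∘f≡id a))

iterate-multiple : ∀ {A : Set} (f : A → A) d a → iterate f d a ≡ a → ∀ y → iterate f (y ℕ.* d) a ≡ a
iterate-multiple f d a f^d≡id zero    = refl
iterate-multiple f d a f^d≡id (suc y) =
  Eq.trans (iterate-+ f d (y ℕ.* d) a) (Eq.trans (cong (iterate f d) (iterate-multiple f d a f^d≡id y)) f^d≡id)

iterate-% : ∀ {A : Set} (f : A → A) p .{{_ : ℕ.NonZero p}} → (∀ a → iterate f p a ≡ a) →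
            ∀ k a → iterate f (k % p) a ≡ iterate f k a
iterate-% f p f^p≡id k a = Eq.sym (begin
    iterate f k a
  ≡⟨ cong (λ z → iterate f z a) (m≡m%n+[m/n]*n k p) ⟩
    iterate f (k % p ℕ.+ (k / p) ℕ.* p) a
  ≡⟨ iterate-+ f (k % p) ((k / p) ℕ.* p) a ⟩
    iterate f (k % p) (iterate f ((k / p) ℕ.* p) a)
  ≡⟨ cong (iterate f (k % p)) (iterate-multiple f p a (f^p≡id a) (k / p)) ⟩
    iterate f (k % p) a
  ∎)
  where open Eq.≡-Reasoning

module PeriodicOrbit {A : Set} (f : A → A) (p : ℕ) .{{_ : ℕ.NonZero p}} (f^p≡id : ∀ a → iterate f p a ≡ a) where

  iterate-mod : ∀ n a → Σ[ m ∈ Fin p ] iterate f n a ≡ iterate f (toℕ m) a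
  iterate-mod n a = fromℕ< (m%n<n n p) ,
    Eq.trans (Eq.sym (iterate-% f p f^p≡id n a)) (cong (λ z → iterate f z a) (Eq.sym (FP.toℕ-fromℕ< (m%n<n n p))))

  orbit-closed : ∀ a (i k : Fin p) → Σ[ m ∈ Fin p ] iterate f (toℕ k) (iterate f (toℕ i) a) ≡ iterate f (toℕ m) a
  orbit-closed a i k with iterate-mod (toℕ k ℕ.+ toℕ i) a
  ... | m , e = m , Eq.trans (Eq.sym (iterate-+ f (toℕ k) (toℕ i) a)) e

  orbit-connected : ∀ a (i j : Fin p) → Σ[ k ∈ Fin p ] iterate f (toℕ k) (iterate f (toℕ i) a) ≡ iterate f (toℕ j) a
  orbit-connected a i j with iterate-mod (toℕ j ℕ.+ (p ℕ.∸ toℕ i)) (iterate f (toℕ i) a)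
  ... | k , e = k , (begin
      iterate f (toℕ k) (iterate f (toℕ i) a)
    ≡⟨ e ⟨
      iterate f (toℕ j ℕ.+ (p ℕ.∸ toℕ i)) (iterate f (toℕ i) a)
    ≡⟨ iterate-+ f (toℕ j) (p ℕ.∸ toℕ i) (iterate f (toℕ i) a) ⟩
      iterate f (toℕ j) (iterate f (p ℕ.∸ toℕ i) (iterate f (toℕ i) a))
    ≡⟨ cong (iterate f (toℕ j)) (iterate-+ f (p ℕ.∸ toℕ i) (toℕ i) a) ⟨
      iterate f (toℕ j) (iterate f (p ℕ.∸ toℕ i ℕ.+ toℕ i) a)
    ≡⟨ cong (λ z → iterate f (toℕ j) (iterate f z a)) (ℕP.m∸n+n≡m (ℕP.<⇒≤ (FP.toℕ<n i))) ⟩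
      iterate f (toℕ j) (iterate f p a)
    ≡⟨ cong (iterate f (toℕ j)) (f^p≡id a) ⟩
      iterate f (toℕ j) a
    ∎)
    where open Eq.≡-Reasoning

-- Bézout: d x = p y ± 1, so f = f^(p y) ∘ f = f^(d x) = id on a (or symmetrically).
prime-period⇒fixed : ∀ {A : Set} (p : ℕ) → Prime p → (f : A → A) → (∀ a → iterate f p a ≡ a) →
                     ∀ a d → 0 ℕ.< d → d ℕ.< p → iterate f d a ≡ a → f a ≡ a
prime-period⇒fixed p p-prime f f^p≡id a d@(suc _) _ d<p f^d[a]≡a with coprime-Bézout (prime⇒coprime p-prime d<p)
... | Bézout.+- x y eq = Eq.trans (cong f (Eq.sym (iterate-multiple f d a f^d[a]≡a y)))
      (Eq.trans (cong (λ z → iterate f z a) eq) (iterate-multiple f p a (f^p≡id a) x))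
... | Bézout.-+ x y eq = Eq.trans (cong f (Eq.sym (iterate-multiple f p a (f^p≡id a) x)))
      (Eq.trans (cong (λ z → iterate f z a) eq) (iterate-multiple f d a f^d[a]≡a y))

argmin : ∀ {p} .{{_ : ℕ.NonZero p}} (g : Fin p → ℕ) → Σ[ i ∈ Fin p ] (∀ k → g i ℕ.≤ g k)
argmin {suc zero}    g = zero , λ { zero → ℕP.≤-refl }
argmin {suc (suc q)} g with argmin (g ∘ suc)
... | i , minimal with g zero ℕP.≤? g (suc i)
...   | yes g0≤gi = zero , λ { zero → ℕP.≤-refl ; (suc k) → ℕP.≤-trans g0≤gi (minimal k) }
...   | no  g0≰gi = suc i , λ { zero → ℕP.<⇒≤ (ℕP.≰⇒> g0≰gi) ; (suc k) → minimal k }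

-- Constructively, the orbit of a non-fixed point is cut out by choosing its element of minimal rank
-- in the enumeration as a representative; every such orbit has exactly p elements.
module PrimeCyclicAction {A : Set} (E : Enumeration A) (p : ℕ) (p-prime : Prime p)
  (φ ψ : A → A) (φψ : ∀ a → φ (ψ a) ≡ a) (ψφ : ∀ a → ψ (φ a) ≡ a)
  (φ^p≡id : ∀ a → iterate φ p a ≡ a) where

  private
    instance
      p-nonZero : ℕ.NonZero p
      p-nonZero = prime⇒nonZero p-prime

  open PeriodicOrbit φ p φ^p≡id public

  fixed-along-orbit : ∀ a i → i ℕ.≤ p → φ (iterate φ i a) ≡ iterate φ i a → φ a ≡ a
  fixed-along-orbit a i i≤p fixed = Eq.subst (λ z → φ z ≡ z) (Eq.sym a≡φ^i[a]) fixed
    where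
    a≡φ^i[a] : a ≡ iterate φ i a
    a≡φ^i[a] = Eq.trans (Eq.sym (φ^p≡id a)) (Eq.trans (cong (λ z → iterate φ z a) (Eq.sym (ℕP.m∸n+n≡m i≤p)))
      (Eq.trans (iterate-+ φ (p ℕ.∸ i) i a) (iterate-fixedPoint φ fixed (p ℕ.∸ i))))

  fixed-if-repeats : ∀ a (i j : Fin p) → toℕ i ℕ.< toℕ j → iterate φ (toℕ i) a ≡ iterate φ (toℕ j) a → φ a ≡ a
  fixed-if-repeats a i j i<j e = fixed-along-orbit a (toℕ i) (ℕP.<⇒≤ (FP.toℕ<n i))
    (prime-period⇒fixed p p-prime φ φ^p≡id (iterate φ (toℕ i) a) (toℕ j ℕ.∸ toℕ i) (ℕP.m<n⇒0<n∸m i<j)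
      (ℕP.≤-<-trans (ℕP.m∸n≤m (toℕ j) (toℕ i)) (FP.toℕ<n j))
      (Eq.trans (Eq.sym (iterate-+ φ (toℕ j ℕ.∸ toℕ i) (toℕ i) a))
        (Eq.trans (cong (λ z → iterate φ z a) (ℕP.m∸n+n≡m (ℕP.<⇒≤ i<j))) (Eq.sym e))))

  orbit-injective : ∀ a → φ a ≢ a → (i j : Fin p) → iterate φ (toℕ i) a ≡ iterate φ (toℕ j) a → i ≡ j
  orbit-injective a unfixed i j e with FP.<-cmp i j
  ... | tri≈ _ i≡j _ = i≡j
  ... | tri< i<j _ _ = ⊥-elim (unfixed (fixed-if-repeats a i j i<j e))
  ... | tri> _ _ j<i = ⊥-elim (unfixed (fixed-if-repeats a j i j<i (Eq.sym e)))

  rank : A → ℕ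
  rank b = toℕ (index E b)

  rank-injective : ∀ {b b′} → rank b ≡ rank b′ → b ≡ b′
  rank-injective {b} {b′} e =
    Eq.trans (Eq.sym (element-index E b)) (Eq.trans (cong (element E) (FP.toℕ-injective e)) (element-index E b′))

  IsOrbitMinimum : A → Set
  IsOrbitMinimum b = ∀ (k : Fin p) → rank b ℕ.≤ rank (iterate φ (toℕ k) b)

  isOrbitMinimum? : ∀ b → Dec (IsOrbitMinimum b)
  isOrbitMinimum? b = FP.all? (λ k → rank b ℕ.≤? rank (iterate φ (toℕ k) b))

  module _ (a : A) (unfixed : φ a ≢ a) where

    minIndex : Fin p
    minIndex = proj₁ (argmin (λ k → rank (iterate φ (toℕ k) a)))

    minIndex-minimal : ∀ (k : Fin p) → rank (iterate φ (toℕ minIndex) a) ℕ.≤ rank (iterate φ (toℕ k) a)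
    minIndex-minimal = proj₂ (argmin (λ k → rank (iterate φ (toℕ k) a)))

    minimum-at-minIndex : IsOrbitMinimum (iterate φ (toℕ minIndex) a)
    minimum-at-minIndex k with orbit-closed a minIndex k
    ... | m , e = Eq.subst (λ z → rank (iterate φ (toℕ minIndex) a) ℕ.≤ rank z) (Eq.sym e) (minIndex-minimal m)

    minimum-unique : ∀ i → IsOrbitMinimum (iterate φ (toℕ i) a) → i ≡ minIndex
    minimum-unique i minimal with orbit-connected a i minIndex
    ... | k , e = orbit-injective a unfixed i minIndex (rank-injective (ℕP.≤-antisym
      (Eq.subst (λ z → rank (iterate φ (toℕ i) a) ℕ.≤ rank z) e (minimal k)) (minIndex-minimal i)))

  module Sums (R : CommutativeRing 0ℓ 0ℓ) (char-p : BigOperators.CharacteristicDivides R p) where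

    open BigOperators R
    open import Relation.Binary.Reasoning.Setoid setoid

    fixed? : ∀ a → Dec (φ a ≡ a)
    fixed? a = _≟E_ E (φ a) a

    𝟙ᶜ : ∀ {P : Set} → Dec P → C
    𝟙ᶜ (yes _) = 0#
    𝟙ᶜ (no _)  = 1#

    𝟙ᶜ-cong : ∀ {P Q : Set} (d : Dec P) (e : Dec Q) → (P → Q) → (Q → P) → 𝟙ᶜ d ≈ 𝟙ᶜ e
    𝟙ᶜ-cong (yes _) (yes _) P→Q Q→P = ≈-refl
    𝟙ᶜ-cong (yes p) (no ¬q) P→Q Q→P = ⊥-elim (¬q (P→Q p))
    𝟙ᶜ-cong (no ¬p) (yes q) P→Q Q→P = ⊥-elim (¬p (Q→P q))
    𝟙ᶜ-cong (no _)  (no _)  P→Q Q→P = ≈-refl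

    representative : A → C
    representative b = 𝟙 (isOrbitMinimum? b)

    Σ-representative : ∀ a → φ a ≢ a → Σ {p} (λ i → representative (iterate φ (toℕ i) a)) ≈ 1#
    Σ-representative a unfixed = ≈-trans (Sum.sum-onlyAt (minIndex a unfixed) _ others) at-minIndex
      where
      others : ∀ i → i ≢ minIndex a unfixed → representative (iterate φ (toℕ i) a) ≈ 0#
      others i i≢ with isOrbitMinimum? (iterate φ (toℕ i) a)
      ... | yes minimal = ⊥-elim (i≢ (minimum-unique a unfixed i minimal))
      ... | no _        = ≈-refl
      at-minIndex : representative (iterate φ (toℕ (minIndex a unfixed)) a) ≈ 1#
      at-minIndex with isOrbitMinimum? (iterate φ (toℕ (minIndex a unfixed)) a)
      ... | yes _          = ≈-refl
      ... | no not-minimal = ⊥-elim (not-minimal (minimum-at-minIndex a unfixed))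

    module _ (T : A → C) (T-invariant : ∀ a → T (φ a) ≈ T a) where

      unfixedPart : A → C
      unfixedPart a = 𝟙ᶜ (fixed? a) * T a

      T-iterate : ∀ k a → T (iterate φ k a) ≈ T a
      T-iterate zero    a = ≈-refl
      T-iterate (suc k) a = ≈-trans (T-invariant (iterate φ k a)) (T-iterate k a)

      unfixedPart-iterate : ∀ (i : Fin p) a → unfixedPart (iterate φ (toℕ i) a) ≈ unfixedPart a
      unfixedPart-iterate i a = *-cong
        (𝟙ᶜ-cong (fixed? (iterate φ (toℕ i) a)) (fixed? a) (fixed-along-orbit a (toℕ i) (ℕP.<⇒≤ (FP.toℕ<n i)))
          (λ fixed → Eq.subst (λ z → φ z ≡ z) (Eq.sym (iterate-fixedPoint φ fixed (toℕ i))) fixed))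
        (T-iterate (toℕ i) a)

      split-fixed : ∀ a → T a ≈ 𝟙 (fixed? a) * T a + unfixedPart a
      split-fixed a with fixed? a
      ... | yes _ = ≈-sym (≈-trans (+-congˡ (zeroˡ _)) (≈-trans (+-identityʳ _) (*-identityˡ _)))
      ... | no _  = ≈-sym (≈-trans (+-congʳ (zeroˡ _)) (≈-trans (+-identityˡ _) (*-identityˡ _)))

      unfixedPart-spread : ∀ a → unfixedPart a ≈ Σ {p} (λ i → unfixedPart a * representative (iterate φ (toℕ i) a))
      unfixedPart-spread a with fixed? a
      ... | yes _ = ≈-trans (zeroˡ (T a)) (≈-sym (Σ-zero {p} _ (λ i → ≈-trans (*-congʳ (zeroˡ (T a))) (zeroˡ _))))
      ... | no unfixed = ≈-trans (≈-sym (*-identityʳ (1# * T a)))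
        (≈-trans (*-congˡ (≈-sym (Σ-representative a unfixed)))
          (*-distribˡ-sum (1# * T a) (λ (i : Fin p) → representative (iterate φ (toℕ i) a))))

      orbit-shift : ∀ (i : Fin p) → ΣE E (λ a → unfixedPart a * representative (iterate φ (toℕ i) a))
                                  ≈ ΣE E (λ b → unfixedPart b * representative b)
      orbit-shift i = ≈-sym (≈-trans
        (ΣE-reindex E E (iterate φ (toℕ i)) (iterate ψ (toℕ i))
          (iterate-inverse ψ φ φψ (toℕ i)) (iterate-inverse φ ψ ψφ (toℕ i)) (λ b → unfixedPart b * representative b))
        (ΣE-cong E (λ a → *-congʳ {representative (iterate φ (toℕ i) a)} (unfixedPart-iterate i a))))

      -- Spreading each unfixed term evenly over its orbit and reindexing along φ^i
      -- turns the unfixed part into p copies of one sum.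
      ΣE-fixedPoints : ΣE E T ≈ ΣE E (λ a → 𝟙 (fixed? a) * T a)
      ΣE-fixedPoints = begin
          ΣE E T                                              ≈⟨ ΣE-cong E split-fixed ⟩
          ΣE E (λ a → 𝟙 (fixed? a) * T a + unfixedPart a)     ≈⟨ ΣE-+ E (λ a → 𝟙 (fixed? a) * T a) unfixedPart ⟩
          ΣE E (λ a → 𝟙 (fixed? a) * T a) + ΣE E unfixedPart  ≈⟨ +-congˡ Σ-unfixed≈0 ⟩
          ΣE E (λ a → 𝟙 (fixed? a) * T a) + 0#                ≈⟨ +-identityʳ _ ⟩
          ΣE E (λ a → 𝟙 (fixed? a) * T a)                     ∎
        where
        Σ-unfixed≈0 : ΣE E unfixedPart ≈ 0#
        Σ-unfixed≈0 = begin
            ΣE E unfixedPart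
          ≈⟨ ΣE-cong E unfixedPart-spread ⟩
            ΣE E (λ a → Σ {p} (λ i → unfixedPart a * representative (iterate φ (toℕ i) a)))
          ≈⟨ ΣE-comm E (finEnumeration p) (λ a i → unfixedPart a * representative (iterate φ (toℕ i) a)) ⟩
            Σ {p} (λ i → ΣE E (λ a → unfixedPart a * representative (iterate φ (toℕ i) a)))
          ≈⟨ Sum.sum-cong-≋ orbit-shift ⟩
            Σ {p} (λ _ → ΣE E (λ b → unfixedPart b * representative b))
          ≈⟨ char-p _ ⟩
            0#
          ∎

n∣n! : ∀ n .{{_ : ℕ.NonZero n}} → n ∣ n ℕ.!
n∣n! (suc n) = m∣m*n (n ℕ.!)

p∤j! : ∀ {p} → Prime p → ∀ j → j ℕ.< p → ¬ (p ∣ j ℕ.!)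
p∤j! p-prime zero    _   p∣1 = ¬prime[1] (Eq.subst Prime (∣1⇒≡1 p∣1) p-prime)
p∤j! p-prime (suc j) j<p p∣j! with euclidsLemma (suc j) (j ℕ.!) p-prime p∣j!
... | inj₁ p∣1+j = ℕP.<-irrefl refl (ℕP.<-≤-trans j<p (∣⇒≤ p∣1+j))
... | inj₂ p∣j!′ = p∤j! p-prime j (ℕP.<-trans (ℕP.n<1+n j) j<p) p∣j!′

p∣pCk : ∀ {p} → Prime p → ∀ k → 0 ℕ.< k → k ℕ.< p → p ∣ p choose k
p∣pCk {p} p-prime k 0<k k<p with euclidsLemma (k ℕ.! ℕ.* (p ℕ.∸ k) ℕ.!) (p choose k) p-prime p∣k![p-k]!pCk
  where
  k≤p = ℕP.<⇒≤ k<p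
  k![p-k]!pCk≡p! : (k ℕ.! ℕ.* (p ℕ.∸ k) ℕ.!) ℕ.* (p choose k) ≡ p ℕ.!
  k![p-k]!pCk≡p! = Eq.trans (ℕP.*-comm (k ℕ.! ℕ.* (p ℕ.∸ k) ℕ.!) (p choose k))
    (Eq.trans (cong (ℕ._* (k ℕ.! ℕ.* (p ℕ.∸ k) ℕ.!)) (nCk≡n!/k![n-k]! k≤p))
    (m/n*n≡m {{ℕP._!*_!≢0 k (p ℕ.∸ k)}} (k![n∸k]!∣n! k≤p)))
  p∣k![p-k]!pCk : p ∣ (k ℕ.! ℕ.* (p ℕ.∸ k) ℕ.!) ℕ.* (p choose k)
  p∣k![p-k]!pCk = Eq.subst (p ∣_) (Eq.sym k![p-k]!pCk≡p!) (n∣n! p {{prime⇒nonZero p-prime}})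
... | inj₂ p∣pCk = p∣pCk
... | inj₁ p∣k![p-k]! with euclidsLemma (k ℕ.!) ((p ℕ.∸ k) ℕ.!) p-prime p∣k![p-k]!
...   | inj₁ p∣k! = ⊥-elim (p∤j! p-prime k k<p p∣k!)
...   | inj₂ p∣[p-k]! = ⊥-elim (p∤j! p-prime (p ℕ.∸ k) (ℕP.∸-monoʳ-< 0<k k≤p) p∣[p-k]!)
  where k≤p = ℕP.<⇒≤ k<p

module Frobenius (R : CommutativeRing 0ℓ 0ℓ) (p : ℕ) where

  open BigOperators R
  open import Relation.Binary.Reasoning.Setoid setoid
  import Algebra.Properties.CommutativeSemiring.Binomial commutativeSemiring as Binomial
  open import Algebra.Properties.Semiring.Exp semiring using (_^_)
  open import Algebra.Properties.Monoid.Mult +-monoid using (×-assocˡ; ×-congʳ; ×-homo-1) renaming (_×_ to _·_)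

  _^ₚ : C → C
  x ^ₚ = Π {p} (λ _ → x)

  ^ₚ-cong : ∀ {x y} → x ≈ y → x ^ₚ ≈ y ^ₚ
  ^ₚ-cong e = Prod.sum-cong-≋ {p} (λ _ → e)

  ^ₚ-* : ∀ x y → (x * y) ^ₚ ≈ x ^ₚ * y ^ₚ
  ^ₚ-* x y = Prod.∑-distrib-+ {p} (λ _ → x) (λ _ → y)

  Π-^ₚ : ∀ {n} (y : Fin n → C) → Π (λ a → y a ^ₚ) ≈ (Π y) ^ₚ
  Π-^ₚ {n} y = Prod.∑-comm {n} {p} (λ a _ → y a)

  ^ₚ≈^ : ∀ n x → Π {n} (λ _ → x) ≈ x ^ n
  ^ₚ≈^ zero    x = ≈-refl
  ^ₚ≈^ (suc n) x = *-congˡ (^ₚ≈^ n x)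

  private
    n×0≈0 : ∀ n → n · 0# ≈ 0#
    n×0≈0 zero    = ≈-refl
    n×0≈0 (suc n) = ≈-trans (+-identityˡ _) (n×0≈0 n)

  module _ (p-prime : Prime p) (char-p : CharacteristicDivides p) where

    0^ₚ≈0 : 0# ^ₚ ≈ 0#
    0^ₚ≈0 = Π-zero (λ _ → 0#) (fromℕ< (ℕ.>-nonZero⁻¹ p {{prime⇒nonZero p-prime}})) ≈-refl

    p·x≈0 : ∀ x → p · x ≈ 0#
    p·x≈0 x = ≈-trans (≈-sym (Sum.sum-replicate p)) (char-p x)

    pCk·x≈0 : ∀ k → 0 ℕ.< k → k ℕ.< p → ∀ x → (p choose k) · x ≈ 0#
    pCk·x≈0 k 0<k k<p x with p∣pCk p-prime k 0<k k<p
    ... | divides d pCk≡d*p = begin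
        (p choose k) · x    ≡⟨ cong (_· x) pCk≡d*p ⟩
        (d ℕ.* p) · x  ≈⟨ ×-assocˡ x d p ⟨
        d · (p · x)    ≈⟨ ×-congʳ d (p·x≈0 x) ⟩
        d · 0#         ≈⟨ n×0≈0 d ⟩
        0#             ∎

    ^ₚ-+ : ∀ x y → (x + y) ^ₚ ≈ x ^ₚ + y ^ₚ
    ^ₚ-+ x y = by-binomial p p-prime refl
      where
      by-binomial : ∀ p′ → Prime p′ → p′ ≡ p → (x + y) ^ₚ ≈ x ^ₚ + y ^ₚ
      by-binomial (suc q) _ refl = begin
          (x + y) ^ₚ
        ≈⟨ ^ₚ≈^ p (x + y) ⟩
          (x + y) ^ p
        ≈⟨ Binomial.theorem p x y ⟩
          term zero + Σ (λ c → term (suc c))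
        ≈⟨ +-congˡ (Sum.sum-init-last (λ c → term (suc c))) ⟩
          term zero + (Σ (λ c → term (suc (F.inject₁ c))) + term (suc (F.fromℕ q)))
        ≈⟨ +-cong term-first (+-cong (Σ-zero _ term-middle) term-last) ⟩
          y ^ₚ + (0# + x ^ₚ)
        ≈⟨ ≈-trans (+-congˡ (+-identityˡ _)) (+-comm _ _) ⟩
          x ^ₚ + y ^ₚ
        ∎
        where
        term : Fin (suc p) → C
        term k = Binomial.binomialTerm x y p k
        term-first : term zero ≈ y ^ₚ
        term-first = ≈-trans (×-homo-1 _) (≈-trans (*-identityˡ _) (≈-sym (^ₚ≈^ p y)))
        term-last : term (suc (F.fromℕ q)) ≈ x ^ₚ
        term-last = begin
            (p choose toℕ (suc (F.fromℕ q))) · (x ^ toℕ (suc (F.fromℕ q)) * y ^ (p ℕ.∸ toℕ (suc (F.fromℕ q))))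
          ≡⟨ cong (λ z → (p choose z) · (x ^ z * y ^ (p ℕ.∸ z))) (cong suc (FP.toℕ-fromℕ q)) ⟩
            (p choose p) · (x ^ p * y ^ (p ℕ.∸ p))
          ≡⟨ cong₂ (λ a b → a · (x ^ p * y ^ b)) (nCn≡1 p) (ℕP.n∸n≡0 p) ⟩
            1 · (x ^ p * 1#)
          ≈⟨ ≈-trans (×-homo-1 _) (*-identityʳ _) ⟩
            x ^ p
          ≈⟨ ^ₚ≈^ p x ⟨
            x ^ₚ
          ∎
        term-middle : ∀ (c : Fin q) → term (suc (F.inject₁ c)) ≈ 0#
        term-middle c = pCk·x≈0 (toℕ (suc (F.inject₁ c))) z<s
          (s<s (Eq.subst (ℕ._< q) (Eq.sym (FP.toℕ-inject₁ c)) (FP.toℕ<n c))) _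

    Σ-^ₚ : ∀ {n} (x : Fin n → C) → Σ (λ c → x c ^ₚ) ≈ (Σ x) ^ₚ
    Σ-^ₚ {zero}  x = ≈-sym 0^ₚ≈0
    Σ-^ₚ {suc n} x = ≈-trans (+-congˡ (Σ-^ₚ (x ∘ suc))) (≈-sym (^ₚ-+ (x zero) (Σ (x ∘ suc))))

    ΣE-^ₚ : ∀ {A} (E : Enumeration A) (u : A → C) → ΣE E (λ a → u a ^ₚ) ≈ ΣE E u ^ₚ
    ΣE-^ₚ E u = Σ-^ₚ (u ∘ element E)

module Rotation (q : ℕ) where

  p : ℕ
  p = suc q

  rotate : Fin p → Fin p
  rotate i = fromℕ< (m%n<n (suc (toℕ i)) p)

  toℕ-rotate : ∀ i → toℕ (rotate i) ≡ suc (toℕ i) % p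
  toℕ-rotate i = FP.toℕ-fromℕ< _

  toℕ-iterate-rotate : ∀ k i → toℕ (iterate rotate k i) ≡ (toℕ i ℕ.+ k) % p
  toℕ-iterate-rotate zero    i =
    Eq.trans (Eq.sym (m<n⇒m%n≡m (FP.toℕ<n i))) (cong (_% p) (Eq.sym (ℕP.+-identityʳ (toℕ i))))
  toℕ-iterate-rotate (suc k) i = begin
      toℕ (rotate (iterate rotate k i))      ≡⟨ toℕ-rotate (iterate rotate k i) ⟩
      suc (toℕ (iterate rotate k i)) % p     ≡⟨ cong (λ z → suc z % p) (toℕ-iterate-rotate k i) ⟩
      (1 ℕ.+ (toℕ i ℕ.+ k) % p) % p          ≡⟨ %-distribˡ-+ 1 ((toℕ i ℕ.+ k) % p) p ⟩
      (1 % p ℕ.+ (toℕ i ℕ.+ k) % p % p) % p  ≡⟨ cong (λ z → (1 % p ℕ.+ z) % p) (m%n%n≡m%n (toℕ i ℕ.+ k) p) ⟩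
      (1 % p ℕ.+ (toℕ i ℕ.+ k) % p) % p      ≡⟨ %-distribˡ-+ 1 (toℕ i ℕ.+ k) p ⟨
      suc (toℕ i ℕ.+ k) % p                  ≡⟨ cong (_% p) (ℕP.+-suc (toℕ i) k) ⟨
      (toℕ i ℕ.+ suc k) % p                  ∎
    where open Eq.≡-Reasoning

  rotate^p≡id : ∀ i → iterate rotate p i ≡ i
  rotate^p≡id i = FP.toℕ-injective
    (Eq.trans (toℕ-iterate-rotate p i) (Eq.trans ([m+n]%n≡m%n (toℕ i) p) (m<n⇒m%n≡m (FP.toℕ<n i))))

  iterate-rotate-zero : ∀ j → iterate rotate (toℕ j) zero ≡ j
  iterate-rotate-zero j = FP.toℕ-injective (Eq.trans (toℕ-iterate-rotate (toℕ j) zero) (m<n⇒m%n≡m (FP.toℕ<n j)))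

  iterate-rotate-comm : ∀ i c → iterate rotate (toℕ i) c ≡ iterate rotate (toℕ c) i
  iterate-rotate-comm i c = begin
      iterate rotate (toℕ i) c
    ≡⟨ cong (iterate rotate (toℕ i)) (iterate-rotate-zero c) ⟨
      iterate rotate (toℕ i) (iterate rotate (toℕ c) zero)
    ≡⟨ iterate-+ rotate (toℕ i) (toℕ c) zero ⟨
      iterate rotate (toℕ i ℕ.+ toℕ c) zero
    ≡⟨ cong (λ z → iterate rotate z zero) (ℕP.+-comm (toℕ i) (toℕ c)) ⟩
      iterate rotate (toℕ c ℕ.+ toℕ i) zero
    ≡⟨ iterate-+ rotate (toℕ c) (toℕ i) zero ⟩
      iterate rotate (toℕ c) (iterate rotate (toℕ i) zero)
    ≡⟨ cong (iterate rotate (toℕ c)) (iterate-rotate-zero i) ⟩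
      iterate rotate (toℕ c) i
    ∎
    where open Eq.≡-Reasoning

  rotate-transitive : ∀ c d → Σ[ j ∈ Fin p ] iterate rotate (toℕ j) c ≡ d
  rotate-transitive c d with PeriodicOrbit.orbit-connected rotate p rotate^p≡id zero c d
  ... | j , e = j , Eq.trans (cong (iterate rotate (toℕ j)) (Eq.sym (iterate-rotate-zero c))) (Eq.trans e (iterate-rotate-zero d))

  module Block (m : ℕ) where

    blockRotate : Fin (m ℕ.* p) → Fin (m ℕ.* p)
    blockRotate x = combine (proj₁ (remQuot {m} p x)) (rotate (proj₂ (remQuot {m} p x)))

    blockRotate-combine : ∀ (a : Fin m) (i : Fin p) → blockRotate (combine a i) ≡ combine a (rotate i)
    blockRotate-combine a i = cong (λ z → combine (proj₁ z) (rotate (proj₂ z))) (FP.remQuot-combine a i)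

    iterate-blockRotate : ∀ k (a : Fin m) (i : Fin p) → iterate blockRotate k (combine a i) ≡ combine a (iterate rotate k i)
    iterate-blockRotate zero    a i = refl
    iterate-blockRotate (suc k) a i =
      Eq.trans (cong blockRotate (iterate-blockRotate k a i)) (blockRotate-combine a (iterate rotate k i))

    blockRotate^p≡id : ∀ x → iterate blockRotate p x ≡ x
    blockRotate^p≡id x = Eq.trans (cong (iterate blockRotate p) (Eq.sym (FP.combine-remQuot {m} p x)))
      (Eq.trans (iterate-blockRotate p a i)
        (Eq.trans (cong (combine a) (rotate^p≡id i)) (FP.combine-remQuot {m} p x)))
      where
      a = proj₁ (remQuot {m} p x)
      i = proj₂ (remQuot {m} p x)

    blockRotate⁻¹ : Fin (m ℕ.* p) → Fin (m ℕ.* p)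
    blockRotate⁻¹ = iterate blockRotate q

    blockRotate-inverseʳ : ∀ x → blockRotate (blockRotate⁻¹ x) ≡ x
    blockRotate-inverseʳ = blockRotate^p≡id

    blockRotate-inverseˡ : ∀ x → blockRotate⁻¹ (blockRotate x) ≡ x
    blockRotate-inverseˡ x = Eq.trans (iterate-comm blockRotate q x) (blockRotate^p≡id x)

-- p = 2t + 1 is odd, so the p-cycle is even: its only inversions are the 2t pairs (i, last).
module RotationSign (R : CommutativeRing 0ℓ 0ℓ) (t : ℕ) where

  open BigOperators R
  open Sign R
  open Rotation (t ℕ.+ t)
  open import Relation.Binary.Reasoning.Setoid setoid

  private
    q : ℕ
    q = t ℕ.+ t

    last : Fin p
    last = F.fromℕ q

    toℕ-last : toℕ last ≡ q
    toℕ-last = FP.toℕ-fromℕ q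

    rotate-last : toℕ (rotate last) ≡ 0
    rotate-last = Eq.trans (toℕ-rotate last) (Eq.trans (cong (λ z → suc z % p) toℕ-last) (n%n≡0 p))

    rotate-<last : ∀ i → toℕ i ℕ.< q → toℕ (rotate i) ≡ suc (toℕ i)
    rotate-<last i i<q = Eq.trans (toℕ-rotate i) (m<n⇒m%n≡m (s<s i<q))

    ≢last⇒<q : ∀ (j : Fin p) → j ≢ last → toℕ j ℕ.< q
    ≢last⇒<q j j≢ =
      ℕP.≤∧≢⇒< (ℕ.s≤s⁻¹ (FP.toℕ<n j)) (λ e → j≢ (FP.toℕ-injective (Eq.trans e (Eq.sym toℕ-last))))

    row-rotate : ∀ i → Π (λ j → when (i FP.<? j) (cmpSign (rotate i) (rotate j))) ≈ when (i FP.<? last) (- 1#)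
    row-rotate i = ≈-trans (Prod.sum-onlyAt last _ others) at-last
      where
      others : ∀ j → j ≢ last → when (i FP.<? j) (cmpSign (rotate i) (rotate j)) ≈ 1#
      others j j≢ with i FP.<? j
      ... | no _    = ≈-refl
      ... | yes i<j = cmpSign-< {x = rotate i} {y = rotate j} (Eq.subst₂ ℕ._<_
            (Eq.sym (rotate-<last i (ℕP.<-trans i<j (≢last⇒<q j j≢)))) (Eq.sym (rotate-<last j (≢last⇒<q j j≢))) (s<s i<j))
      at-last : when (i FP.<? last) (cmpSign (rotate i) (rotate last)) ≈ when (i FP.<? last) (- 1#)
      at-last with i FP.<? last
      ... | no _       = ≈-refl
      ... | yes i<last = cmpSign-> {x = rotate i} {y = rotate last} (Eq.subst₂ ℕ._<_
            (Eq.sym rotate-last) (Eq.sym (rotate-<last i (Eq.subst (toℕ i ℕ.<_) toℕ-last i<last))) z<s)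

  sgn-rotate : sgn rotate ≈ 1#
  sgn-rotate = begin
      sgn rotate
    ≈⟨ Prod.sum-cong-≋ row-rotate ⟩
      Π (λ (i : Fin p) → when (i FP.<? last) (- 1#))
    ≈⟨ Prod.sum-init-last (λ (i : Fin p) → when (i FP.<? last) (- 1#)) ⟩
      Π (λ (c : Fin q) → when (F.inject₁ c FP.<? last) (- 1#)) * when (last FP.<? last) (- 1#)
    ≈⟨ *-cong (Prod.sum-cong-≋ (λ c → when-yes (F.inject₁ c FP.<? last) (inject₁<last c) (- 1#)))
              (when-no (last FP.<? last) (FP.<-irrefl refl) (- 1#)) ⟩
      Π {q} (λ _ → - 1#) * 1#
    ≈⟨ ≈-trans (*-identityʳ _) (Π-const-even t (- 1#) -1*-1≈1) ⟩
      1#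
    ∎
    where
    inject₁<last : ∀ (c : Fin q) → F.inject₁ c < last
    inject₁<last c = Eq.subst₂ ℕ._<_ (Eq.sym (FP.toℕ-inject₁ c)) (Eq.sym toℕ-last) (FP.toℕ<n c)

  rotatePermutation : Permutation p p
  rotatePermutation = Perm.permutation rotate (iterate rotate q) rotate^p≡id
    (λ i → Eq.trans (iterate-comm rotate q i) (rotate^p≡id i))

  sgn-iterate-rotate : ∀ k → sgn {p} {p} (iterate rotate k) ≈ 1#
  sgn-iterate-rotate zero    = sgn-id {p}
  sgn-iterate-rotate (suc k) = begin
      sgn (iterate rotate (suc k))                             ≈⟨ sgn-cong (λ i → Eq.sym (iterate-comm rotate k i)) ⟩
      sgn (λ i → iterate rotate k (rotatePermutation ⟨$⟩ʳ i))   ≈⟨ sgn-∘-permutation rotatePermutation (iterate rotate k) ⟩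
      sgn (iterate rotate k) * sgn rotate                      ≈⟨ *-cong (sgn-iterate-rotate k) sgn-rotate ⟩
      1# * 1#                                                  ≈⟨ *-identityˡ 1# ⟩
      1#                                                       ∎

  sgn-rotation : ∀ (c : Fin p) → sgn {p} (λ i → iterate rotate (toℕ i) c) ≈ 1#
  sgn-rotation c = ≈-trans (sgn-cong {p} (λ i → iterate-rotate-comm i c)) (sgn-iterate-rotate (toℕ c))

module EquivariantMaps (q m : ℕ) where

  open Rotation q
  open Block m

  N : ℕ
  N = m ℕ.* p

  by-combine : (P : Fin N → Set) → (∀ a i → P (combine a i)) → ∀ x → P x
  by-combine P on-combine x =
    Eq.subst P (FP.combine-remQuot {m} p x) (on-combine (proj₁ (remQuot {m} p x)) (proj₂ (remQuot {m} p x)))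

  blockRotatePermutation : Permutation N N
  blockRotatePermutation = Perm.permutation blockRotate blockRotate⁻¹ blockRotate-inverseʳ blockRotate-inverseˡ

  conjugate conjugate⁻¹ : Vec (Fin N) N → Vec (Fin N) N
  conjugate  f = tabulate (λ x → blockRotate⁻¹ (lookup f (blockRotate x)))
  conjugate⁻¹ f = tabulate (λ x → blockRotate (lookup f (blockRotate⁻¹ x)))

  lookup-conjugate : ∀ f x → lookup (conjugate f) x ≡ blockRotate⁻¹ (lookup f (blockRotate x))
  lookup-conjugate f x = VP.lookup∘tabulate _ x

  conjugate-inverseʳ : ∀ f → conjugate (conjugate⁻¹ f) ≡ f
  conjugate-inverseʳ f = lookup-extensionality λ x → begin
      lookup (conjugate (conjugate⁻¹ f)) x
    ≡⟨ lookup-conjugate (conjugate⁻¹ f) x ⟩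
      blockRotate⁻¹ (lookup (conjugate⁻¹ f) (blockRotate x))
    ≡⟨ cong blockRotate⁻¹ (VP.lookup∘tabulate _ (blockRotate x)) ⟩
      blockRotate⁻¹ (blockRotate (lookup f (blockRotate⁻¹ (blockRotate x))))
      
    ≡⟨ blockRotate-inverseˡ _ ⟩
      lookup f (blockRotate⁻¹ (blockRotate x))
    ≡⟨ cong (lookup f) (blockRotate-inverseˡ x) ⟩
      lookup f x
    ∎
    where open Eq.≡-Reasoning

  conjugate-inverseˡ : ∀ f → conjugate⁻¹ (conjugate f) ≡ f
  conjugate-inverseˡ f = lookup-extensionality λ x → Eq.trans (VP.lookup∘tabulate _ x)
    (Eq.trans (cong blockRotate (lookup-conjugate f (blockRotate⁻¹ x)))
      (Eq.trans (blockRotate-inverseʳ _) (cong (lookup f) (blockRotate-inverseʳ x))))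

  lookup-iterate-conjugate : ∀ k f x →
    lookup (iterate conjugate k f) x ≡ iterate blockRotate⁻¹ k (lookup f (iterate blockRotate k x))
  lookup-iterate-conjugate zero    f x = refl
  lookup-iterate-conjugate (suc k) f x = Eq.trans (lookup-conjugate (iterate conjugate k f) x)
    (cong blockRotate⁻¹ (Eq.trans (lookup-iterate-conjugate k f (blockRotate x))
      (cong (λ z → iterate blockRotate⁻¹ k (lookup f z)) (iterate-comm blockRotate k x))))

  conjugate^p≡id : ∀ f → iterate conjugate p f ≡ f
  conjugate^p≡id f = lookup-extensionality λ x → Eq.trans (lookup-iterate-conjugate p f x)
    (Eq.trans (cong (λ z → iterate blockRotate⁻¹ p (lookup f z)) (blockRotate^p≡id x)) (blockRotate⁻¹^p≡id _))
    where
    blockRotate⁻¹^p≡id : ∀ y → iterate blockRotate⁻¹ p y ≡ y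
    blockRotate⁻¹^p≡id y = Eq.trans (cong (iterate blockRotate⁻¹ p) (Eq.sym (blockRotate^p≡id y)))
      (iterate-inverse blockRotate blockRotate⁻¹ blockRotate-inverseˡ p y)

  extend : Vec (Fin N) m → Vec (Fin N) N
  extend g = tabulate λ x → iterate blockRotate (toℕ (proj₂ (remQuot {m} p x))) (lookup g (proj₁ (remQuot {m} p x)))

  restrict : Vec (Fin N) N → Vec (Fin N) m
  restrict f = tabulate (λ a → lookup f (combine a zero))

  lookup-extend : ∀ g a i → lookup (extend g) (combine a i) ≡ iterate blockRotate (toℕ i) (lookup g a)
  lookup-extend g a i = Eq.trans (VP.lookup∘tabulate _ (combine a i))
    (cong (λ z → iterate blockRotate (toℕ (proj₂ z)) (lookup g (proj₁ z))) (FP.remQuot-combine a i))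

  restrict-extend : ∀ g → restrict (extend g) ≡ g
  restrict-extend g = lookup-extensionality λ a → Eq.trans (VP.lookup∘tabulate _ a) (lookup-extend g a zero)

  combine≡iterate-blockRotate : ∀ a (i : Fin p) → combine a i ≡ iterate blockRotate (toℕ i) (combine a zero)
  combine≡iterate-blockRotate a i =
    Eq.sym (Eq.trans (iterate-blockRotate (toℕ i) a zero) (cong (combine a) (iterate-rotate-zero i)))

  extend-fixed : ∀ g → conjugate (extend g) ≡ extend g
  extend-fixed g = lookup-extensionality (by-combine _ on-combine)
    where
    open Eq.≡-Reasoning
    on-combine : ∀ a i → lookup (conjugate (extend g)) (combine a i) ≡ lookup (extend g) (combine a i)
    on-combine a i = begin
        lookup (conjugate (extend g)) (combine a i)
      ≡⟨ lookup-conjugate (extend g) (combine a i) ⟩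
        blockRotate⁻¹ (lookup (extend g) (blockRotate (combine a i)))
      ≡⟨ cong (λ z → blockRotate⁻¹ (lookup (extend g) z)) (blockRotate-combine a i) ⟩
        blockRotate⁻¹ (lookup (extend g) (combine a (rotate i)))
      ≡⟨ cong blockRotate⁻¹ (lookup-extend g a (rotate i)) ⟩
        blockRotate⁻¹ (iterate blockRotate (toℕ (rotate i)) (lookup g a))
      ≡⟨ cong (λ z → blockRotate⁻¹ (iterate blockRotate z (lookup g a))) (toℕ-rotate i) ⟩
        blockRotate⁻¹ (iterate blockRotate (suc (toℕ i) % p) (lookup g a))
      ≡⟨ cong blockRotate⁻¹ (iterate-% blockRotate p blockRotate^p≡id (suc (toℕ i)) (lookup g a)) ⟩
        blockRotate⁻¹ (blockRotate (iterate blockRotate (toℕ i) (lookup g a)))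
      ≡⟨ blockRotate-inverseˡ _ ⟩
        iterate blockRotate (toℕ i) (lookup g a)
      ≡⟨ lookup-extend g a i ⟨
        lookup (extend g) (combine a i)
      ∎

  fixed⇒extended : ∀ f → conjugate f ≡ f → f ≡ extend (restrict f)
  fixed⇒extended f fixed = lookup-extensionality (by-combine _ on-combine)
    where
    commutes : ∀ x → lookup f (blockRotate x) ≡ blockRotate (lookup f x)
    commutes x = Eq.trans (Eq.sym (blockRotate-inverseʳ _))
      (cong blockRotate (Eq.trans (Eq.sym (lookup-conjugate f x)) (cong (λ z → lookup z x) fixed)))
    commutes-iterate : ∀ k x → lookup f (iterate blockRotate k x) ≡ iterate blockRotate k (lookup f x)
    commutes-iterate zero    x = refl
    commutes-iterate (suc k) x = Eq.trans (commutes (iterate blockRotate k x)) (cong blockRotate (commutes-iterate k x))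
    on-combine : ∀ a i → lookup f (combine a i) ≡ lookup (extend (restrict f)) (combine a i)
    on-combine a i = Eq.trans (cong (lookup f) (combine≡iterate-blockRotate a i))
      (Eq.trans (commutes-iterate (toℕ i) (combine a zero))
        (Eq.sym (Eq.trans (lookup-extend (restrict f) a i) (cong (iterate blockRotate (toℕ i)) (VP.lookup∘tabulate _ a)))))


module BlockCirculant (R : CommutativeRing 0ℓ 0ℓ) (t m : ℕ) where

  open BigOperators R
  open Sign R
  open Determinant R
  open RotationSign R t using (sgn-rotation)
  open Rotation (t ℕ.+ t)
  open Block m
  open EquivariantMaps (t ℕ.+ t) m
  open Frobenius R p
  open import Relation.Binary.Reasoning.Setoid setoid

  _≟ᵥ_ : (f g : Vec (Fin N) N) → Dec (f ≡ g)
  _≟ᵥ_ = _≟E_ (maps N N)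

  𝟙-fixed≈Σ𝟙-extend : ∀ f → 𝟙 (conjugate f ≟ᵥ f) ≈ ΣE (maps m N) (λ g → 𝟙 (f ≟ᵥ extend g))
  𝟙-fixed≈Σ𝟙-extend f with conjugate f ≟ᵥ f
  ... | yes fixed = ≈-sym (≈-trans (ΣE-onlyAt (maps m N) (restrict f) _ other) at-restriction)
    where
    other : ∀ g → g ≢ restrict f → 𝟙 (f ≟ᵥ extend g) ≈ 0#
    other g g≢ with f ≟ᵥ extend g
    ... | yes f≡ = ⊥-elim (g≢ (Eq.trans (Eq.sym (restrict-extend g)) (cong restrict (Eq.sym f≡))))
    ... | no _   = ≈-refl
    at-restriction : 𝟙 (f ≟ᵥ extend (restrict f)) ≈ 1#
    at-restriction with f ≟ᵥ extend (restrict f)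
    ... | yes _ = ≈-refl
    ... | no f≢ = ⊥-elim (f≢ (fixed⇒extended f fixed))
  ... | no unfixed = ≈-sym (ΣE-zero (maps m N) _ none)
    where
    none : ∀ g → 𝟙 (f ≟ᵥ extend g) ≈ 0#
    none g with f ≟ᵥ extend g
    ... | yes f≡ = ⊥-elim (unfixed (Eq.trans (cong conjugate f≡) (Eq.trans (extend-fixed g) (Eq.sym f≡))))
    ... | no _   = ≈-refl

  Σ-fixed≈Σ-extend : ∀ (T : Vec (Fin N) N → C) →
    ΣE (maps N N) (λ f → 𝟙 (conjugate f ≟ᵥ f) * T f) ≈ ΣE (maps m N) (λ g → T (extend g))
  Σ-fixed≈Σ-extend T = begin
      ΣE (maps N N) (λ f → 𝟙 (conjugate f ≟ᵥ f) * T f)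
    ≈⟨ ΣE-cong (maps N N) (λ f → ≈-trans (*-congʳ (𝟙-fixed≈Σ𝟙-extend f))
                                         (*-distribʳ-ΣE (maps m N) (T f) (λ g → 𝟙 (f ≟ᵥ extend g)))) ⟩
      ΣE (maps N N) (λ f → ΣE (maps m N) (λ g → 𝟙 (f ≟ᵥ extend g) * T f))
    ≈⟨ ΣE-comm (maps N N) (maps m N) (λ f g → 𝟙 (f ≟ᵥ extend g) * T f) ⟩
      ΣE (maps m N) (λ g → ΣE (maps N N) (λ f → 𝟙 (f ≟ᵥ extend g) * T f))
    ≈⟨ ΣE-cong (maps m N) (λ g → ≈-trans (ΣE-onlyAt (maps N N) (extend g) _ (other g)) (at-extension g)) ⟩
      ΣE (maps m N) (λ g → T (extend g))
    ∎
    where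
    other : ∀ g f → f ≢ extend g → 𝟙 (f ≟ᵥ extend g) * T f ≈ 0#
    other g f f≢ with f ≟ᵥ extend g
    ... | yes f≡ = ⊥-elim (f≢ f≡)
    ... | no _   = zeroˡ _
    at-extension : ∀ g → 𝟙 (extend g ≟ᵥ extend g) * T (extend g) ≈ T (extend g)
    at-extension g with extend g ≟ᵥ extend g
    ... | yes _  = *-identityˡ _
    ... | no g≢g = ⊥-elim (g≢g refl)

  module _ (τ : Vec (Fin m) m) (k : Vec (Fin p) m) where

    private
      F : Fin N → Fin N
      F = lookup (extend (V.zipWith combine τ k))
      shifted : Fin m → Fin p → Fin p
      shifted a i = iterate rotate (toℕ i) (lookup k a)
      pairSign : Fin m → Fin p → Fin m → Fin p → C
      pairSign a i b j = when (combine a i FP.<? combine b j) (cmpSign (F (combine a i)) (F (combine b j)))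
      blockSign : Fin m → Fin m → C
      blockSign a b = Π (λ (i : Fin p) → Π (λ (j : Fin p) → pairSign a i b j))

    F-combine : ∀ a i → F (combine a i) ≡ combine (lookup τ a) (shifted a i)
    F-combine a i = Eq.trans (lookup-extend (V.zipWith combine τ k) a i)
      (Eq.trans (cong (iterate blockRotate (toℕ i)) (VP.lookup-zipWith combine a τ k))
        (iterate-blockRotate (toℕ i) (lookup τ a) (lookup k a)))

    sgn-by-blocks : sgn F ≈ Π (λ a → Π (λ b → blockSign a b))
    sgn-by-blocks = begin
        sgn F
      ≈⟨ Prod.sum-cong-≋ (λ x → Prod.sum-combine m p (λ y → when (x FP.<? y) (cmpSign (F x) (F y)))) ⟩
        Π (λ x → Π (λ (b : Fin m) → Π (λ (j : Fin p) → when (x FP.<? combine b j) (cmpSign (F x) (F (combine b j))))))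
      ≈⟨ Prod.sum-combine m p _ ⟩
        Π (λ (a : Fin m) → Π (λ (i : Fin p) → Π (λ (b : Fin m) → Π (λ (j : Fin p) → pairSign a i b j))))
      ≈⟨ Prod.sum-cong-≋ (λ a → Prod.∑-comm (λ i b → Π (λ j → pairSign a i b j))) ⟩
        Π (λ a → Π (λ b → blockSign a b))
      ∎

    -- Off the diagonal each block contributes the same sign p² times; on the diagonal it is the sign of a rotation.
    blockSign≈ : Injective _≡_ _≡_ (lookup τ) →
                 ∀ a b → blockSign a b ≈ when (a FP.<? b) (cmpSign (lookup τ a) (lookup τ b))
    blockSign≈ τ-injective a b with FP.<-cmp a b
    ... | tri< a<b _ _ = begin
        blockSign a b
      ≈⟨ Prod.sum-cong-≋ (λ i → Prod.sum-cong-≋ (λ j →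
           ≈-trans (when-yes (combine a i FP.<? combine b j) (FP.combine-monoˡ-< i j a<b) _)
             (≈-trans (reflexive (cong₂ cmpSign (F-combine a i) (F-combine b j)))
               (cmpSign-combine-≢ (lookup τ a) (lookup τ b) _ _ τa≢τb)))) ⟩
        Π {p} (λ _ → Π {p} (λ _ → σ))
      ≈⟨ ≈-trans (Prod.sum-cong-≋ {p} (λ _ → Π-const-odd t σ σ²≈1)) (Π-const-odd t σ σ²≈1) ⟩
        σ
      ≈⟨ when-yes (a FP.<? b) a<b σ ⟨
        when (a FP.<? b) σ
      ∎
      where
      σ = cmpSign (lookup τ a) (lookup τ b)
      τa≢τb : lookup τ a ≢ lookup τ b
      τa≢τb e = FP.<-irrefl (τ-injective e) a<b
      σ²≈1 = cmpSign² (lookup τ a) (lookup τ b) τa≢τb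
    ... | tri≈ _ refl _ = begin
        blockSign a a
      ≈⟨ Prod.sum-cong-≋ (λ i → Prod.sum-cong-≋ (λ j →
           when-cong (combine a i FP.<? combine a j) (i FP.<? j) (combine-cancelʳ-< a) (combine-monoʳ-< a)
             (≈-trans (reflexive (cong₂ cmpSign (F-combine a i) (F-combine a j)))
               (cmpSign-combine-≡ (lookup τ a) (shifted a i) (shifted a j))))) ⟩
        sgn (shifted a)
      ≈⟨ sgn-rotation (lookup k a) ⟩
        1#
      ≈⟨ when-no (a FP.<? a) (FP.<-irrefl refl) _ ⟨
        when (a FP.<? a) (cmpSign (lookup τ a) (lookup τ a))
      ∎
    ... | tri> _ _ b<a = ≈-trans
      (≈-trans (Prod.sum-cong-≋ (λ i → Prod.sum-cong-≋ (λ j →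
          when-no (combine a i FP.<? combine b j) (λ lt → FP.<-asym lt (FP.combine-monoˡ-< j i b<a))
            (cmpSign (F (combine a i)) (F (combine b j))))))
        (≈-trans (Prod.sum-cong-≋ {p} (λ _ → Prod.sum-replicate-zero p)) (Prod.sum-replicate-zero p)))
      (≈-sym (when-no (a FP.<? b) (λ a<b → FP.<-asym a<b b<a) (cmpSign (lookup τ a) (lookup τ b))))

    sgn-extend : sgn F ≈ sgn (lookup τ)
    sgn-extend with collision⊎injective (lookup τ)
    ... | inj₂ τ-injective =
      ≈-trans sgn-by-blocks (Prod.sum-cong-≋ (λ a → Prod.sum-cong-≋ (blockSign≈ τ-injective a)))
    ... | inj₁ (a , b , a<b , τa≡τb) =
      ≈-trans (sgn-nonInjective F (combine a zero) (combine b j) distinct collide)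
              (≈-sym (sgn-collision _ (a , b , a<b , τa≡τb)))
      where
      j = proj₁ (rotate-transitive (lookup k b) (lookup k a))
      distinct : combine a zero ≢ combine b j
      distinct e = FP.<-irrefl (FP.combine-injectiveˡ a zero b j e) a<b
      collide : F (combine a zero) ≡ F (combine b j)
      collide = Eq.trans (F-combine a zero) (Eq.trans
        (cong₂ combine τa≡τb (Eq.sym (proj₂ (rotate-transitive (lookup k b) (lookup k a))))) (Eq.sym (F-combine b j)))

  module _ (M : Fin N → Fin N → C) (M-invariant : ∀ x y → M (blockRotate x) (blockRotate y) ≈ M x y) where

    term : Vec (Fin N) N → C
    term f = sgn (lookup f) * Π (λ x → M x (lookup f x))

    term-conjugate : ∀ f → term (conjugate f) ≈ term f
    term-conjugate f = *-cong
      (≈-trans (sgn-cong (lookup-conjugate f)) (sgn-conjugate blockRotatePermutation (lookup f)))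
      (begin
          Π (λ x → M x (lookup (conjugate f) x))
        ≈⟨ Prod.sum-cong-≋ (λ x → ≈-trans (reflexive (cong (M x) (lookup-conjugate f x)))
             (≈-trans (≈-sym (M-invariant x _)) (reflexive (cong (M (blockRotate x)) (blockRotate-inverseʳ _))))) ⟩
          Π (λ x → M (blockRotate x) (lookup f (blockRotate x)))
        ≈⟨ Prod.sum-permute (λ y → M y (lookup f y)) blockRotatePermutation ⟨
          Π (λ y → M y (lookup f y))
        ∎)

    M-invariant-iterate : ∀ k x y → M (iterate blockRotate k x) (iterate blockRotate k y) ≈ M x y
    M-invariant-iterate zero    x y = ≈-refl
    M-invariant-iterate (suc k) x y = ≈-trans (M-invariant _ _) (M-invariant-iterate k x y)

    Π-extend : ∀ g → Π (λ x → M x (lookup (extend g) x)) ≈ Π (λ a → M (combine a zero) (lookup g a) ^ₚ)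
    Π-extend g = ≈-trans (Prod.sum-combine m p (λ x → M x (lookup (extend g) x)))
      (Prod.sum-cong-≋ (λ a → Prod.sum-cong-≋ (λ i →
        ≈-trans (reflexive (cong₂ M (combine≡iterate-blockRotate a i) (lookup-extend g a i)))
          (M-invariant-iterate (toℕ i) (combine a zero) (lookup g a)))))

  module _ (p-prime : Prime p) (char-p : CharacteristicDivides p) where

    open PrimeCyclicAction (maps N N) p p-prime conjugate conjugate⁻¹ conjugate-inverseʳ conjugate-inverseˡ conjugate^p≡id
    open Sums R char-p

    sgn≈sgn^ₚ : ∀ {n} (τ : Vec (Fin n) n) → sgn (lookup τ) ≈ sgn (lookup τ) ^ₚ
    sgn≈sgn^ₚ τ with collision⊎injective (lookup τ)
    ... | inj₁ c   =
      ≈-trans (sgn-collision _ c) (≈-sym (≈-trans (^ₚ-cong (sgn-collision _ c)) (0^ₚ≈0 p-prime char-p)))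
    ... | inj₂ inj = ≈-sym (Π-const-odd t _ (sgn-permutation² (injective⇒permutation (lookup τ) inj)))

    module _ (M : Fin N → Fin N → C) (M-invariant : ∀ x y → M (blockRotate x) (blockRotate y) ≈ M x y) where

      quotient : Fin m → Fin m → C
      quotient a b = Σ {p} (λ c → M (combine a zero) (combine b c))

      leibniz-blockCirculant : leibniz M ≈ leibniz quotient ^ₚ
      leibniz-blockCirculant = begin
          leibniz M
        ≈⟨ ΣE-fixedPoints (term M M-invariant) (term-conjugate M M-invariant) ⟩
          ΣE (maps N N) (λ f → 𝟙 (conjugate f ≟ᵥ f) * term M M-invariant f)
        ≈⟨ Σ-fixed≈Σ-extend (term M M-invariant) ⟩
          ΣE (maps m N) (λ g → term M M-invariant (extend g))
        ≈⟨ ΣE-cong (maps m N) (λ g → *-congˡ {sgn (lookup (extend g))} (Π-extend M M-invariant g)) ⟩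
          ΣE (maps m N) (λ g → sgn (lookup (extend g)) * Π (λ a → M (combine a zero) (lookup g a) ^ₚ))
        ≈⟨ ΣE-maps-combine m (λ g → sgn (lookup (extend g)) * Π (λ a → M (combine a zero) (lookup g a) ^ₚ)) ⟩
          ΣE (maps m m) (λ τ → ΣE (maps m p) (λ k →
            sgn (lookup (extend (V.zipWith combine τ k))) * Π (λ a → M (combine a zero) (lookup (V.zipWith combine τ k) a) ^ₚ)))
        ≈⟨ ΣE-cong (maps m m) (λ τ → ΣE-cong (maps m p) (λ k → *-cong (sgn-extend τ k)
             (Prod.sum-cong-≋ (λ a → reflexive (cong (λ z → M (combine a zero) z ^ₚ) (VP.lookup-zipWith combine a τ k)))))) ⟩
          ΣE (maps m m) (λ τ → ΣE (maps m p) (λ k → sgn (lookup τ) * Π (λ a → entry τ a (lookup k a) ^ₚ)))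
        ≈⟨ ΣE-cong (maps m m) (λ τ → *-distribˡ-ΣE (maps m p) (sgn (lookup τ)) (λ k → Π (λ a → entry τ a (lookup k a) ^ₚ))) ⟨
          ΣE (maps m m) (λ τ → sgn (lookup τ) * ΣE (maps m p) (λ k → Π (λ a → entry τ a (lookup k a) ^ₚ)))
        ≈⟨ ΣE-cong (maps m m) (λ τ → *-congˡ {sgn (lookup τ)} (Π-ΣE (finEnumeration p) m (λ a c → entry τ a c ^ₚ))) ⟨
          ΣE (maps m m) (λ τ → sgn (lookup τ) * Π (λ a → Σ (λ c → entry τ a c ^ₚ)))
        ≈⟨ ΣE-cong (maps m m) (λ τ → *-cong (sgn≈sgn^ₚ τ)
             (≈-trans (Prod.sum-cong-≋ (λ a → Σ-^ₚ p-prime char-p (entry τ a)))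
                      (Π-^ₚ (λ a → quotient a (lookup τ a))))) ⟩
          ΣE (maps m m) (λ τ → sgn (lookup τ) ^ₚ * Π (λ a → quotient a (lookup τ a)) ^ₚ)
        ≈⟨ ΣE-cong (maps m m) (λ τ → ^ₚ-* (sgn (lookup τ)) (Π (λ a → quotient a (lookup τ a)))) ⟨
          ΣE (maps m m) (λ τ → (sgn (lookup τ) * Π (λ a → quotient a (lookup τ a))) ^ₚ)
        ≈⟨ ΣE-^ₚ p-prime char-p (maps m m) (λ τ → sgn (lookup τ) * Π (λ a → quotient a (lookup τ a))) ⟩
          leibniz quotient ^ₚ
        ∎
        where
        entry : Vec (Fin m) m → Fin m → Fin p → C
        entry τ a c = M (combine a zero) (combine (lookup τ a) c)

δ-refl : ∀ {n} (i : Fin n) → δ i i ≡ X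
δ-refl zero    = refl
δ-refl (suc i) = δ-refl i

δ-≢ : ∀ {n} (i j : Fin n) → i ≢ j → δ i j ≡ []
δ-≢ zero    zero    i≢j = ⊥-elim (i≢j refl)
δ-≢ zero    (suc j) i≢j = refl
δ-≢ (suc i) zero    i≢j = refl
δ-≢ (suc i) (suc j) i≢j = δ-≢ i j (λ e → i≢j (cong suc e))

module FrobeniusOnPolynomials (t : ℕ) (p-prime : Prime (suc (t ℕ.+ t))) where

  p : ℕ
  p = suc (t ℕ.+ t)

  open PolynomialsModP p
    using (𝔽ₚ[x]; mk≈; mk∼; ∼-reflexive; ∼-refl; ∷-cong; shift-cong; scaleP-zero; *P-identityˡ; [0]≈[]; shift; coeff-+P)
  open BigOperators 𝔽ₚ[x]
  open Determinant 𝔽ₚ[x]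
  open Frobenius 𝔽ₚ[x] p
  open import Relation.Binary.Reasoning.Setoid setoid

  coeff-Σ-const : ∀ n f k → coeff (Σ {n} (λ _ → f)) k ≡ + n ℤ.* coeff f k
  coeff-Σ-const zero    f k = Eq.sym (ℤP.*-zeroˡ (coeff f k))
  coeff-Σ-const (suc n) f k =
    Eq.trans (coeff-+P f (Σ {n} (λ _ → f)) k) (Eq.trans (cong (λ z → coeff f k ℤ.+ z) (coeff-Σ-const n f k))
      (Eq.trans (c+nc≡[1+n]c (coeff f k) (+ n)) (cong (ℤ._* coeff f k) (Eq.sym (ℤP.pos-+ 1 n)))))
    where
    c+nc≡[1+n]c : ∀ c a → c ℤ.+ a ℤ.* c ≡ (+ 1 ℤ.+ a) ℤ.* c
    c+nc≡[1+n]c = solve-∀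

  𝔽ₚ[x]-characteristic : CharacteristicDivides p
  𝔽ₚ[x]-characteristic f = mk≈ λ k → mk∼ (ℤS.divides (coeff f k)
    (Eq.trans (cong (ℤ._- + 0) (coeff-Σ-const p f k)) (pc-0≡cp (+ p) (coeff f k))))
    where
    pc-0≡cp : ∀ a c → a ℤ.* c ℤ.- + 0 ≡ c ℤ.* a
    pc-0≡cp = solve-∀

  det≡laplace : ∀ {n} (M : Fin n → Fin n → Poly) → det M ≡ laplace M
  det≡laplace {zero}  M = refl
  det≡laplace {suc n} M = sumFinP≡Σ (λ j → Eq.trans (signP≡alternate (toℕ j) _)
      (cong (λ z → alternate (toℕ j) (M zero j *P z)) (det≡laplace (λ r c → M (suc r) (punchIn j c)))))
    where
    sumFinP≡Σ : ∀ {n} {f g : Fin n → Poly} → (∀ i → f i ≡ g i) → sumFinP f ≡ Σ g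
    sumFinP≡Σ {zero}  e = refl
    sumFinP≡Σ {suc n} e = cong₂ _+P_ (e zero) (sumFinP≡Σ (e ∘ suc))
    signP≡alternate : ∀ k q → signP k q ≡ alternate k q
    signP≡alternate zero          q = refl
    signP≡alternate (suc zero)    q = refl
    signP≡alternate (suc (suc k)) q = signP≡alternate k q

  X*P≈shift : ∀ u → X *P u ≈ shift u
  X*P≈shift u = ≈-trans (+-cong (scaleP-zero u ∼-refl) (shift-cong (*P-identityˡ u))) (+-identityˡ (shift u))

  X^k*P≈padding : ∀ k u → Π {k} (λ _ → X) *P u ≈ replicate k (+ 0) ++ u
  X^k*P≈padding zero    u = *P-identityˡ u
  X^k*P≈padding (suc k) u =
    ≈-trans (*-assoc X (Π {k} (λ _ → X)) u) (≈-trans (*-congˡ {X} (X^k*P≈padding k u)) (X*P≈shift _))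

  ∷≈constP+X*P : ∀ a as → a ∷ as ≈ constP a +P X *P as
  ∷≈constP+X*P a as =
    ≈-sym (≈-trans (+-congˡ {constP a} (X*P≈shift as)) (∷-cong (∼-reflexive (ℤP.+-identityʳ a)) (+-identityˡ as)))

  substXPow-∷ : ∀ a v → substXPow p (a ∷ v) ≈ constP a +P (X ^ₚ) *P substXPow p v
  substXPow-∷ a v = ≈-sym (≈-trans (+-congˡ {constP a} (X^k*P≈padding p (substXPow p v)))
    (∷-cong (∼-reflexive (ℤP.+-identityʳ a)) (+-identityˡ _)))

  [n]^ₚ≈[n] : ∀ n → constP (+ n) ^ₚ ≈ constP (+ n)
  [n]^ₚ≈[n] zero    = ≈-trans (^ₚ-cong [0]≈[]) (≈-trans (0^ₚ≈0 p-prime 𝔽ₚ[x]-characteristic) (≈-sym [0]≈[]))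
  [n]^ₚ≈[n] (suc n) = begin
      (1# + constP (+ n)) ^ₚ        ≈⟨ ^ₚ-+ p-prime 𝔽ₚ[x]-characteristic 1# (constP (+ n)) ⟩
      1# ^ₚ + constP (+ n) ^ₚ       ≈⟨ +-cong (Prod.sum-replicate-zero p) ([n]^ₚ≈[n] n) ⟩
      1# + constP (+ n)            ∎

  -- Fermat's little theorem, coefficientwise; for negative constants it uses (-1)^p = -1.
  [a]^ₚ≈[a] : ∀ a → constP a ^ₚ ≈ constP a
  [a]^ₚ≈[a] (+ n)     = [n]^ₚ≈[n] n
  [a]^ₚ≈[a] -[1+ n ] = begin
      constP -[1+ n ] ^ₚ                    ≈⟨ ^ₚ-cong [-1-n]≈-1*[1+n] ⟩
      (- 1# * constP (+ suc n)) ^ₚ          ≈⟨ ^ₚ-* (- 1#) (constP (+ suc n)) ⟩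
      (- 1#) ^ₚ * constP (+ suc n) ^ₚ       ≈⟨ *-cong (Π-const-odd t (- 1#) -1*-1≈1) ([n]^ₚ≈[n] (suc n)) ⟩
      - 1# * constP (+ suc n)               ≈⟨ [-1-n]≈-1*[1+n] ⟨
      constP -[1+ n ]                       ∎
    where
    [-1-n]≈-1*[1+n] : constP -[1+ n ] ≈ - 1# * constP (+ suc n)
    [-1-n]≈-1*[1+n] = mk≈ λ { zero → ∼-reflexive (Eq.sym (-1*1*a+0≡-a (+ suc n))) ; (suc k) → ∼-refl }
      where
      -1*1*a+0≡-a : ∀ a → (ℤ.- (+ 1) ℤ.* + 1) ℤ.* a ℤ.+ + 0 ≡ ℤ.- a
      -1*1*a+0≡-a = solve-∀

  ^ₚ≈substXPow : ∀ f → f ^ₚ ≈ substXPow p f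
  ^ₚ≈substXPow []       = ≈-refl
  ^ₚ≈substXPow (a ∷ as) = begin
      (a ∷ as) ^ₚ                          ≈⟨ ^ₚ-cong (∷≈constP+X*P a as) ⟩
      (constP a + X * as) ^ₚ               ≈⟨ ^ₚ-+ p-prime 𝔽ₚ[x]-characteristic (constP a) (X * as) ⟩
      constP a ^ₚ + (X * as) ^ₚ            ≈⟨ +-cong ([a]^ₚ≈[a] a) (≈-trans (^ₚ-* X as)
                                                                  (*-congˡ {X ^ₚ} (^ₚ≈substXPow as))) ⟩
      constP a + X ^ₚ * substXPow p as     ≈⟨ substXPow-∷ a as ⟨
      substXPow p (a ∷ as)                 ∎

iter≡iterate : ∀ {n} (h : Fin n → Fin n) k v → iter h k v ≡ iterate h k v
iter≡iterate h zero    v = refl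
iter≡iterate h (suc k) v = cong h (iter≡iterate h k v)

-- A transversal s of the free ℤ/p-action identifies Fin (m · p) with the vertex set via
-- combine a i ↦ hⁱ (s a), which turns h into the block rotation.
module OrbitCoordinates (q : ℕ) {n m : ℕ} (h : Fin n → Fin n) (s : Fin m → Fin n)
  (h^p≡id : ∀ v → iter h (suc q) v ≡ v)
  (free : ∀ v i → 1 ℕ.≤ i → i ℕ.< suc q → ¬ (iter h i v ≡ v))
  (transversal : IsOrbitTransversal (suc q) h s) where

  open Rotation q
  open Block m
  open Eq.≡-Reasoning

  private
    N = m ℕ.* p

    h^p≡id′ : ∀ v → iterate h p v ≡ v
    h^p≡id′ v = Eq.trans (Eq.sym (iter≡iterate h p v)) (h^p≡id v)

    orbit-index : Fin n → Fin m
    orbit-index v = proj₁ (proj₁ transversal v)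

    orbit-exponent : Fin n → ℕ
    orbit-exponent v = proj₁ (proj₂ (proj₁ transversal v))

    reaches : ∀ v → iterate h (orbit-exponent v) (s (orbit-index v)) ≡ v
    reaches v = Eq.trans (Eq.sym (iter≡iterate h (orbit-exponent v) (s (orbit-index v))))
                         (proj₂ (proj₂ (proj₁ transversal v)))

    same-orbit : ∀ a b i → iterate h i (s a) ≡ s b → a ≡ b
    same-orbit a b i e = proj₂ transversal a b i (Eq.trans (iter≡iterate h i (s a)) e)

    orbit-distinct : ∀ v {c d} → d ℕ.< c → c ℕ.< p → ¬ (iterate h c v ≡ iterate h d v)
    orbit-distinct v {c} {d} d<c c<p e = free (iterate h d v) (c ℕ.∸ d) (ℕP.m<n⇒0<n∸m d<c)
      (ℕP.≤-<-trans (ℕP.m∸n≤m c d) c<p)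
      (Eq.trans (iter≡iterate h (c ℕ.∸ d) (iterate h d v)) (Eq.trans (Eq.sym (iterate-+ h (c ℕ.∸ d) d v))
        (Eq.trans (cong (λ z → iterate h z v) (ℕP.m∸n+n≡m (ℕP.<⇒≤ d<c))) e)))

  orbit-injective : ∀ v c d → c ℕ.< p → d ℕ.< p → iterate h c v ≡ iterate h d v → c ≡ d
  orbit-injective v c d c<p d<p e with ℕP.<-cmp c d
  ... | tri≈ _ c≡d _ = c≡d
  ... | tri< c<d _ _ = ⊥-elim (orbit-distinct v c<d d<p (Eq.sym e))
  ... | tri> _ _ d<c = ⊥-elim (orbit-distinct v d<c c<p e)

  β : Fin N → Fin n
  β x = iterate h (toℕ (proj₂ (remQuot {m} p x))) (s (proj₁ (remQuot {m} p x)))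

  β-combine : ∀ a i → β (combine a i) ≡ iterate h (toℕ i) (s a)
  β-combine a i = cong (λ z → iterate h (toℕ (proj₂ z)) (s (proj₁ z))) (FP.remQuot-combine a i)

  β⁻¹ : Fin n → Fin N
  β⁻¹ v = combine (orbit-index v) (fromℕ< (m%n<n (orbit-exponent v) p))

  β-β⁻¹ : ∀ v → β (β⁻¹ v) ≡ v
  β-β⁻¹ v = begin
      β (β⁻¹ v)
    ≡⟨ β-combine a (fromℕ< (m%n<n i p)) ⟩
      iterate h (toℕ (fromℕ< (m%n<n i p))) (s a)
    ≡⟨ cong (λ z → iterate h z (s a)) (FP.toℕ-fromℕ< (m%n<n i p)) ⟩
      iterate h (i % p) (s a)
    ≡⟨ iterate-% h p h^p≡id′ i (s a) ⟩
      iterate h i (s a)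
    ≡⟨ reaches v ⟩
      v
    ∎
    where
    a = orbit-index v
    i = orbit-exponent v

  β⁻¹-β-combine : ∀ a i → β⁻¹ (β (combine a i)) ≡ combine a i
  β⁻¹-β-combine a i = cong₂ combine a′≡a (FP.toℕ-injective (Eq.trans (FP.toℕ-fromℕ< _)
      (orbit-injective (s a) (i′ % p) (toℕ i) (m%n<n i′ p) (FP.toℕ<n i)
        (Eq.trans (iterate-% h p h^p≡id′ i′ (s a))
          (Eq.trans (cong (λ z → iterate h i′ (s z)) (Eq.sym a′≡a)) (Eq.trans (reaches v) (β-combine a i)))))))
    where
    v  = β (combine a i)
    a′ = orbit-index v
    i′ = orbit-exponent v
    a′≡a : a′ ≡ a
    a′≡a = same-orbit a′ a (p ℕ.∸ toℕ i ℕ.+ i′) (begin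
        iterate h (p ℕ.∸ toℕ i ℕ.+ i′) (s a′)
      ≡⟨ iterate-+ h (p ℕ.∸ toℕ i) i′ (s a′) ⟩
        iterate h (p ℕ.∸ toℕ i) (iterate h i′ (s a′))
      ≡⟨ cong (iterate h (p ℕ.∸ toℕ i)) (Eq.trans (reaches v) (β-combine a i)) ⟩
        iterate h (p ℕ.∸ toℕ i) (iterate h (toℕ i) (s a))
      ≡⟨ iterate-+ h (p ℕ.∸ toℕ i) (toℕ i) (s a) ⟨
        iterate h (p ℕ.∸ toℕ i ℕ.+ toℕ i) (s a)
      ≡⟨ cong (λ z → iterate h z (s a)) (ℕP.m∸n+n≡m (ℕP.<⇒≤ (FP.toℕ<n i))) ⟩
        iterate h p (s a)
      ≡⟨ h^p≡id′ (s a) ⟩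
        s a
      ∎)

  βPermutation : Permutation N n
  βPermutation = Perm.permutation β β⁻¹ β-β⁻¹ λ x →
    Eq.subst (λ y → β⁻¹ (β y) ≡ y) (FP.combine-remQuot {m} p x)
      (β⁻¹-β-combine (proj₁ (remQuot {m} p x)) (proj₂ (remQuot {m} p x)))

  β-blockRotate : ∀ x → β (blockRotate x) ≡ h (β x)
  β-blockRotate x = Eq.subst (λ y → β (blockRotate y) ≡ h (β y)) (FP.combine-remQuot {m} p x)
      (on-combine (proj₁ (remQuot {m} p x)) (proj₂ (remQuot {m} p x)))
    where
    on-combine : ∀ a i → β (blockRotate (combine a i)) ≡ h (β (combine a i))
    on-combine a i = begin
      β (blockRotate (combine a i))           ≡⟨ cong β (blockRotate-combine a i) ⟩
      β (combine a (rotate i))                ≡⟨ β-combine a (rotate i) ⟩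
      iterate h (toℕ (rotate i)) (s a)        ≡⟨ cong (λ z → iterate h z (s a)) (toℕ-rotate i) ⟩
      iterate h (suc (toℕ i) % p) (s a)       ≡⟨ iterate-% h p h^p≡id′ (suc (toℕ i)) (s a) ⟩
      h (iterate h (toℕ i) (s a))             ≡⟨ cong h (β-combine a i) ⟨
      h (β (combine a i))                     ∎

  h-injective : ∀ {u v} → h u ≡ h v → u ≡ v
  h-injective {u} {v} e = begin
      u                       ≡⟨ h^p≡id′ u ⟨
      h (iterate h q u)       ≡⟨ iterate-comm h q u ⟨
      iterate h q (h u)       ≡⟨ cong (iterate h q) e ⟩
      iterate h q (h v)       ≡⟨ iterate-comm h q v ⟩
      h (iterate h q v)       ≡⟨ h^p≡id′ v ⟩
      v                       ∎

charMatrix : ∀ {k} → Weight k → Fin k → Fin k → Poly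
charMatrix w i j = δ i j +P negP (constP (+ w i j))

module PeriodicGraph (t : ℕ) (p-prime : Prime (suc (t ℕ.+ t))) {n m : ℕ} (w : Weight n)
  (h : Fin n → Fin n) (s : Fin m → Fin n)
  (periodic : PeriodicBy (suc (t ℕ.+ t)) w h) (transversal : IsOrbitTransversal (suc (t ℕ.+ t)) h s) where

  open Rotation (t ℕ.+ t) using (p)
  open Rotation.Block (t ℕ.+ t) m using (blockRotate)
  open OrbitCoordinates (t ℕ.+ t) h s (proj₁ (proj₂ periodic)) (proj₂ (proj₂ periodic)) transversal
    using (β; β-combine; βPermutation; β-blockRotate; h-injective)
  open PolynomialsModP p using (𝔽ₚ[x]; [0]≈[])
  open BigOperators 𝔽ₚ[x]
  open Determinant 𝔽ₚ[x]
  open Frobenius 𝔽ₚ[x] p using (_^ₚ; ^ₚ-cong)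
  open FrobeniusOnPolynomials t p-prime using (𝔽ₚ[x]-characteristic; det≡laplace; ^ₚ≈substXPow)
  open BlockCirculant 𝔽ₚ[x] t m using (quotient; leibniz-blockCirculant)
  open import Relation.Binary.Reasoning.Setoid setoid

  private
    free : ∀ v i → 1 ℕ.≤ i → i ℕ.< p → ¬ (iterate h i v ≡ v)
    free v i 1≤i i<p e = proj₂ (proj₂ periodic) v i 1≤i i<p (Eq.trans (iter≡iterate h i v) e)

    same-orbit : ∀ a b i → iterate h i (s a) ≡ s b → a ≡ b
    same-orbit a b i e = proj₂ transversal a b i (Eq.trans (iter≡iterate h i (s a)) e)

  δ-h : ∀ u v → δ (h u) (h v) ≡ δ u v
  δ-h u v with u F.≟ v
  ... | yes refl = Eq.trans (δ-refl (h u)) (Eq.sym (δ-refl u))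
  ... | no u≢v   = Eq.trans (δ-≢ (h u) (h v) (λ e → u≢v (h-injective e))) (Eq.sym (δ-≢ u v u≢v))

  A : Fin (m ℕ.* p) → Fin (m ℕ.* p) → Poly
  A x y = charMatrix w (β x) (β y)

  A-invariant : ∀ x y → A (blockRotate x) (blockRotate y) ≈ A x y
  A-invariant x y = begin
      charMatrix w (β (blockRotate x)) (β (blockRotate y))
    ≡⟨ cong₂ (charMatrix w) (β-blockRotate x) (β-blockRotate y) ⟩
      charMatrix w (h (β x)) (h (β y))
    ≡⟨ cong₂ (λ d a → d +P negP (constP (+ a))) (δ-h (β x) (β y)) (proj₁ periodic (β x) (β y)) ⟩
      charMatrix w (β x) (β y)
    ∎

  Σ-neg : ∀ {k} (f : Fin k → Poly) → Σ (λ c → - f c) ≈ - Σ f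
  Σ-neg {zero}  f = ≈-sym -0#≈0#
  Σ-neg {suc k} f = ≈-trans (+-congˡ (Σ-neg (f ∘ suc))) (-‿+-comm (f zero) (Σ (f ∘ suc)))

  Σ-constP : ∀ k (f : ℕ → ℕ) → Σ {k} (λ c → constP (+ f (toℕ c))) ≈ constP (+ sumℕ k f)
  Σ-constP zero    f = ≈-sym [0]≈[]
  Σ-constP (suc k) f = ≈-trans (Sum.sum-init-last {k} (λ c → constP (+ f (toℕ c))))
    (+-cong (≈-trans (Sum.sum-cong-≋ {k} (λ c → reflexive (cong (λ z → constP (+ f z)) (FP.toℕ-inject₁ c))))
                     (Σ-constP k f))
            (reflexive (cong (λ z → constP (+ f z)) (FP.toℕ-fromℕ k))))

  Σ-δ-orbit : ∀ a b → Σ {p} (λ c → δ (s a) (iterate h (toℕ c) (s b))) ≈ δ a b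
  Σ-δ-orbit a b with a F.≟ b
  ... | yes refl = ≈-trans (Sum.sum-onlyAt zero (λ c → δ (s a) (iterate h (toℕ c) (s a))) off-diagonal)
      (reflexive (Eq.trans (δ-refl (s a)) (Eq.sym (δ-refl a))))
    where
    off-diagonal : ∀ c → c ≢ zero → δ (s a) (iterate h (toℕ c) (s a)) ≈ []
    off-diagonal c c≢0 = reflexive (δ-≢ (s a) _ (λ e →
      free (s a) (toℕ c) (ℕP.n≢0⇒n>0 (λ e′ → c≢0 (FP.toℕ-injective e′))) (FP.toℕ<n c) (Eq.sym e)))
  ... | no a≢b = ≈-trans (Σ-zero {p} (λ c → δ (s a) (iterate h (toℕ c) (s b))) other-orbit)
      (reflexive (Eq.sym (δ-≢ a b a≢b)))
    where
    other-orbit : ∀ c → δ (s a) (iterate h (toℕ c) (s b)) ≈ []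
    other-orbit c = reflexive (δ-≢ (s a) _ (λ e → a≢b (Eq.sym (same-orbit b a (toℕ c) (Eq.sym e)))))

  quotient≈charMatrix : ∀ a b →
    quotient p-prime 𝔽ₚ[x]-characteristic A A-invariant a b ≈ charMatrix (quotientWeight p w h s) a b
  quotient≈charMatrix a b = begin
      Σ {p} (λ c → A (combine a zero) (combine b c))
    ≈⟨ Sum.sum-cong-≋ (λ c → reflexive (cong₂ (charMatrix w) (β-combine a zero) (β-combine b c))) ⟩
      Σ {p} (λ c → δ (s a) (h^ c (s b)) + - constP (+ w (s a) (h^ c (s b))))
    ≈⟨ Sum.∑-distrib-+ (λ c → δ (s a) (h^ c (s b))) (λ c → - constP (+ w (s a) (h^ c (s b)))) ⟩
      Σ {p} (λ c → δ (s a) (h^ c (s b))) + Σ {p} (λ c → - constP (+ w (s a) (h^ c (s b))))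
    ≈⟨ +-cong (Σ-δ-orbit a b) (≈-trans (Σ-neg (λ c → constP (+ w (s a) (h^ c (s b)))))
                                      (-‿cong (Σ-constP p (λ i → w (s a) (iterate h i (s b)))))) ⟩
      δ a b + - constP (+ sumℕ p (λ i → w (s a) (iterate h i (s b))))
    ≡⟨ cong (λ z → δ a b + - constP (+ z)) (sumℕ-cong p (λ i → cong (w (s a)) (Eq.sym (iter≡iterate h i (s b))))) ⟩
      charMatrix (quotientWeight p w h s) a b
    ∎
    where
    h^ : Fin p → Fin n → Fin n
    h^ c = iterate h (toℕ c)
    sumℕ-cong : ∀ k {f g : ℕ → ℕ} → (∀ i → f i ≡ g i) → sumℕ k f ≡ sumℕ k g
    sumℕ-cong zero    e = refl
    sumℕ-cong (suc k) e = cong₂ ℕ._+_ (sumℕ-cong k e) (e k)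

  charPoly≈substXPow : charPoly w ≈ substXPow p (charPoly (quotientWeight p w h s))
  charPoly≈substXPow = begin
      charPoly w
    ≡⟨ det≡laplace (charMatrix w) ⟩
      laplace (charMatrix w)
    ≈⟨ laplace≈leibniz (charMatrix w) ⟩
      leibniz (charMatrix w)
    ≈⟨ leibniz-relabel βPermutation (charMatrix w) ⟩
      leibniz A
    ≈⟨ leibniz-blockCirculant p-prime 𝔽ₚ[x]-characteristic A A-invariant ⟩
      leibniz (quotient p-prime 𝔽ₚ[x]-characteristic A A-invariant) ^ₚ
    ≈⟨ ^ₚ-cong (leibniz-cong quotient≈charMatrix) ⟩
      leibniz (charMatrix (quotientWeight p w h s)) ^ₚ
    ≈⟨ ^ₚ-cong (laplace≈leibniz (charMatrix (quotientWeight p w h s))) ⟨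
      laplace (charMatrix (quotientWeight p w h s)) ^ₚ
    ≡⟨ cong _^ₚ (det≡laplace (charMatrix (quotientWeight p w h s))) ⟨
      charPoly (quotientWeight p w h s) ^ₚ
    ≈⟨ ^ₚ≈substXPow (charPoly (quotientWeight p w h s)) ⟩
      substXPow p (charPoly (quotientWeight p w h s))
    ∎

odd⇒2t+1 : ∀ p → ¬ (2 ∣ p) → ∃ λ t → p ≡ suc (t ℕ.+ t)
odd⇒2t+1 zero          2∤p = ⊥-elim (2∤p (divides 0 refl))
odd⇒2t+1 (suc zero)    2∤p = 0 , refl
odd⇒2t+1 (suc (suc p)) 2∤p with odd⇒2t+1 p (λ { (divides q eq) → 2∤p (divides (suc q) (cong (2 ℕ.+_) eq)) })
... | t , refl = suc t , cong (λ z → suc (suc z)) (Eq.sym (ℕP.+-suc t t))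

theorem1p1 : (p : ℕ) → Prime p → ¬ (2 ∣ p) →
    (n : ℕ) (w : Weight n) → Symmetric w →
    (h : Fin n → Fin n) → PeriodicBy p w h →
    (m : ℕ) (s : Fin m → Fin n) → IsOrbitTransversal p h s →
    charPoly w ≡P substXPow p (charPoly (quotientWeight p w h s)) mod p
theorem1p1 p p-prime p-odd n w _ h periodic m s transversal with odd⇒2t+1 p p-odd
... | t , refl = PolynomialsModP.≈⇒≡P-mod p (PeriodicGraph.charPoly≈substXPow t p-prime w h s periodic transversal)
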